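{- Let $n$ be either $p^\alpha$ with $p$ an odd prime and $\alpha\ge 1$, or $n=p^\alpha q^\beta$ with $p,q$ distinct odd primes, $\alpha,\beta\ge1$ and $\gcd(\varphi(p^\alpha),\varphi(q^\beta))=2$; suppose in either case that $\varphi(n)/4$ is an odd integer. Then the quadratic residues $\mathrm{mod}^\star\, n$ form a cyclic subgroup of $G_n^\star$ of order $\varphi(n)/4$, and for every quadratic residue $b$ $\mathrm{mod}^\star\, n$, the integer $x=b^{(\varphi(n)/4+1)/2}$ satisfies $x^2\equiv b\ (\mathrm{mod}^\star\, n)$ and is itself a quadratic residue $\mathrm{mod}^\star\, n$.
   Context: For a positive integer $n$ and integers $a,b$ coprime to $n$, write $a\equiv b\ (\mathrm{mod}^\star\, n)$ if $a-b\in n\mathbb{Z}$ or $a+b\in n\mathbb{Z}$. $G_n^\star$ is the group of equivalence classes of integers coprime to $n$ under this relation with multiplication $[a][b]=[ab]$. An integer $b$ coprime to $n$ is a quadratic residue $\mathrm{mod}^\star\, n$ if $b\equiv y^2\ (\mathrm{mod}^\star\, n)$ for some integer $y$ coprime to $n$. $\varphi$ is Euler's totient function. -}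

module Defs where

open import Data.Nat as ℕ using (ℕ; zero; suc; _^_; _%_; _/_)
open import Data.Nat.GCD using (gcd)
open import Data.Nat.Primality using (Prime)
open import Data.Nat.Coprimality using (coprime?)
import Data.Nat.Coprimality as NC
open import Data.Integer as ℤ using (ℤ; +_; ∣_∣; _-_; _+_; _*_)
open import Data.Integer.Divisibility using (_∣_)
open import Data.List using (List; length; filter; upTo; map)
open import Data.List.Relation.Unary.All using (All)
open import Data.List.Relation.Unary.Any using (Any)
open import Data.List.Relation.Unary.AllPairs using (AllPairs)
open import Data.Product using (Σ; ∃; ∃-syntax; _×_; _,_)
open import Data.Sum using (_⊎_)
open import Relation.Nullary using (¬_)
open import Relation.Binary.PropositionalEquality using (_≡_; _≢_)

φ : ℕ → ℕ
φ n = length (filter (λ k → coprime? k n) (map suc (upTo n)))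

CoprimeTo : ℕ → ℤ → Set
CoprimeTo n a = NC.Coprime ∣ a ∣ n

infix 4 _≡⋆_[mod_]
_≡⋆_[mod_] : ℤ → ℤ → ℕ → Set
a ≡⋆ b [mod n ] = ((+ n) ∣ (a - b)) ⊎ ((+ n) ∣ (a + b))

QR : ℕ → ℤ → Set
QR n b = CoprimeTo n b × ∃[ y ] (CoprimeTo n y × b ≡⋆ y ℤ.^ 2 [mod n ])

-- A subset S of ℤ, saturated w.r.t. ≡⋆, describing a subgroup of G⋆_n
IsSubgroup : ℕ → (ℤ → Set) → Set
IsSubgroup n S =
    (∀ a → S a → CoprimeTo n a)
  × (∀ a b → S a → a ≡⋆ b [mod n ] → S b)
  × S (+ 1)
  × (∀ a b → S a → S b → S (a * b))
  × (∀ a → S a → ∃[ c ] (S c × (a * c) ≡⋆ + 1 [mod n ]))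

IsCyclic : ℕ → (ℤ → Set) → Set
IsCyclic n S = ∃[ g ] (S g × (∀ b → S b → ∃[ k ] (b ≡⋆ g ℤ.^ k [mod n ])))

-- the set of ≡⋆-classes contained in S has exactly m elements:
-- there is a list of m pairwise inequivalent elements of S meeting every class in S
HasOrder : ℕ → (ℤ → Set) → ℕ → Set
HasOrder n S m = Σ (List ℤ) λ L →
    All S L
  × AllPairs (λ a b → ¬ (a ≡⋆ b [mod n ])) L
  × (∀ b → S b → Any (λ a → b ≡⋆ a [mod n ]) L)
  × length L ≡ m

ShapeN : ℕ → Set
ShapeN n =
    (∃[ p ] ∃[ α ] (Prime p × p ≢ 2 × α ℕ.≥ 1 × n ≡ p ^ α))
  ⊎ (∃[ p ] ∃[ q ] ∃[ α ] ∃[ β ]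
       (Prime p × Prime q × p ≢ 2 × q ≢ 2 × p ≢ q × α ℕ.≥ 1 × β ℕ.≥ 1
        × gcd (φ (p ^ α)) (φ (q ^ β)) ≡ 2
        × n ≡ p ^ α ℕ.* q ^ β))

module Submission where

-- Everything follows once we have a unit y whose square c = y² has order
-- exactly m in G⋆ₙ and whose powers exhaust the squares of all units
-- (QuadraticResidues.SquareGenerator): then the quadratic residues are the classes
-- c⁰, …, c^(m-1), they form a cyclic subgroup of order m, every residue b satisfies
-- bᵐ ≡ ±1, and hence b^((m+1)/2) squares to ±b.  Such a y comes from primitive roots:
-- for n = p^α a primitive root h has order 4m and h^(2m) ≡ -1, so h² has order m in
-- G⋆ₙ; for n = p^α q^β with φ(p^α) = 2a, φ(q^β) = 2b (a, b odd and coprime, ab = m)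
-- we glue primitive roots of both factors by the Chinese remainder theorem.

module NatFacts where

  open import Data.Nat as ℕ using (ℕ; zero; suc; _+_; _*_; _^_; _∸_; _≤_; _<_; z≤n; s≤s; _%_; _/_)
  import Data.Nat.Properties as ℕP
  open import Data.Nat.DivMod using (m≡m%n+[m/n]*n; m%n<n)
  open import Data.Nat.Divisibility as ℕ∣ using (_∣_; _∣?_; divides; ∣-trans; ∣1⇒≡1; m%n≡0⇒n∣m)
  open import Data.Nat.Coprimality as Coprimality using (Coprime; coprime-divisor)
  open import Data.Nat.Primality using (Prime; prime⇒irreducible; prime⇒nonTrivial; prime⇒nonZero; prime[2])
  open import Data.Nat.Primality.Factorisation using (factorise; PrimeFactorisation)
  open PrimeFactorisation using (factors; isFactorisation; factorsPrime)
  open import Data.Nat.ListAction using (product)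
  open import Data.Nat.Induction using (<-wellFounded)
  open import Induction.WellFounded using (Acc; acc)
  open import Data.Fin using (toℕ; fromℕ<)
  open import Data.Fin.Properties using (pigeonhole; toℕ<n; toℕ-fromℕ<)
  open import Data.List using (List; []; _∷_)
  open import Data.List.Relation.Unary.All using (All; []; _∷_)
  open import Data.Empty using (⊥-elim)
  open import Data.Product using (∃-syntax; _×_; _,_; proj₁; proj₂)
  open import Data.Sum using (_⊎_; inj₁; inj₂)
  open import Relation.Nullary using (¬_; yes; no)
  open import Relation.Binary.PropositionalEquality using (_≡_; _≢_; refl; sym; trans; cong; subst)

  factors-pos : ∀ k e → 1 ≤ k * e → 1 ≤ k × 1 ≤ e
  factors-pos (suc k) (suc e) _ = s≤s z≤n , s≤s z≤n
  factors-pos (suc k) zero h = ⊥-elim (ℕP.<-irrefl (sym (ℕP.*-zeroʳ k)) h)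

  prime>1 : ∀ {p} → Prime p → 1 < p
  prime>1 {p} pp = ℕ.nonTrivial⇒n>1 p {{prime⇒nonTrivial pp}}

  prime≡suc : ∀ {p} → Prime p → p ≡ suc (p ∸ 1)
  prime≡suc {p} pp = sym (ℕP.suc-pred p {{prime⇒nonZero pp}})

  prime-coprime : ∀ {p a} → Prime p → ¬ (p ∣ a) → Coprime p a
  prime-coprime pp p∤a (d∣p , d∣a) with prime⇒irreducible pp d∣p
  ... | inj₁ d≡1 = d≡1
  ... | inj₂ refl = ⊥-elim (p∤a d∣a)

  distinct-primes-coprime : ∀ {p q} → Prime p → Prime q → p ≢ q → Coprime p q
  distinct-primes-coprime {p} {q} pp pq p≢q = prime-coprime pp p∤q
    where
    p∤q : ¬ (p ∣ q)
    p∤q p∣q with prime⇒irreducible pq p∣q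
    ... | inj₁ refl = ℕP.<-irrefl refl (prime>1 pp)
    ... | inj₂ p≡q = p≢q p≡q

  prime∣2⇒≡2 : ∀ {p} → Prime p → p ∣ 2 → p ≡ 2
  prime∣2⇒≡2 pp p∣2 with prime⇒irreducible prime[2] p∣2
  ... | inj₁ refl = ⊥-elim (ℕP.<-irrefl refl (prime>1 pp))
  ... | inj₂ p≡2 = p≡2

  coprime-*ˡ : ∀ {x y a} → Coprime x a → Coprime y a → Coprime (x * y) a
  coprime-*ˡ {x} cx cy {d} (d∣xy , d∣a) = cy (coprime-divisor d⊥x d∣xy , d∣a)
    where
    d⊥x : Coprime d x
    d⊥x (e∣d , e∣x) = cx (e∣x , ∣-trans e∣d d∣a)

  coprime-^ˡ : ∀ {x a} k → Coprime x a → Coprime (x ^ k) a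
  coprime-^ˡ zero c (d∣1 , _) = ∣1⇒≡1 d∣1
  coprime-^ˡ (suc k) c = coprime-*ˡ c (coprime-^ˡ k c)

  coprime-∣-* : ∀ {a b k} → Coprime a b → a ∣ k → b ∣ k → a * b ∣ k
  coprime-∣-* {a} {b} c (divides q refl) b∣qa
    with coprime-divisor (Coprimality.sym c) (subst (b ∣_) (ℕP.*-comm q a) b∣qa)
  ... | divides t refl = divides t (trans (ℕP.*-assoc t b a) (cong (t *_) (ℕP.*-comm b a)))

  ^-∣-^ : ∀ q {e f} → e ≤ f → q ^ e ∣ q ^ f
  ^-∣-^ q {e} {f} e≤f = divides (q ^ (f ∸ e))
    (trans (cong (q ^_) (sym (ℕP.m+[n∸m]≡n e≤f)))
           (trans (ℕP.^-distribˡ-+-* q e (f ∸ e)) (ℕP.*-comm (q ^ e) _)))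

  odd⇒suc-double : ∀ n → n % 2 ≡ 1 → n ≡ suc (n / 2 * 2)
  odd⇒suc-double n n%2≡1 = trans (m≡m%n+[m/n]*n n 2) (cong (_+ n / 2 * 2) n%2≡1)

  odd-prime : ∀ {p} → Prime p → p ≢ 2 → p ≡ suc (p / 2 * 2)
  odd-prime {p} pp p≢2 = odd⇒suc-double p (remainder (p % 2) refl (m%n<n p 2))
    where
    remainder : ∀ r → p % 2 ≡ r → r < 2 → p % 2 ≡ 1
    remainder zero p%2≡0 _ = ⊥-elim (p≢2 (sym (two≡p (prime⇒irreducible pp (m%n≡0⇒n∣m p 2 p%2≡0)))))
      where
      two≡p : 2 ≡ 1 ⊎ 2 ≡ p → 2 ≡ p
      two≡p (inj₂ e) = e
    remainder (suc zero) p%2≡1 _ = p%2≡1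
    remainder (suc (suc r)) _ (s≤s (s≤s ()))

  prime-divisor : ∀ n → 2 ≤ n → ∃[ q ] (Prime q × q ∣ n)
  prime-divisor n n≥2 = first-factor (factors f) (isFactorisation f) (factorsPrime f)
    where
    f : PrimeFactorisation n
    f = factorise n {{ℕ.>-nonZero (ℕP.<-trans (s≤s z≤n) n≥2)}}
    first-factor : (qs : List ℕ) → n ≡ product qs → All Prime qs → ∃[ q ] (Prime q × q ∣ n)
    first-factor [] n≡1 _ = ⊥-elim (ℕP.<-irrefl (sym n≡1) n≥2)
    first-factor (q ∷ qs) n≡ (pq ∷ _) = q , pq , divides (product qs) (trans n≡ (ℕP.*-comm q _))

  valuation : ∀ q → 1 < q → ∀ D → 1 ≤ D → ∃[ f ] ∃[ D′ ] (D ≡ q ^ f * D′ × ¬ (q ∣ D′))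
  valuation q q>1 D D≥1 = go D D≥1 (<-wellFounded D)
    where
    go : ∀ D → 1 ≤ D → Acc _<_ D → ∃[ f ] ∃[ D′ ] (D ≡ q ^ f * D′ × ¬ (q ∣ D′))
    go D D≥1 (acc smaller) with q ∣? D
    ... | no q∤D = 0 , D , sym (ℕP.+-identityʳ D) , q∤D
    ... | yes (divides D₁ refl) with go D₁ D₁≥1 (smaller D₁<D)
      where
      D₁≥1 : 1 ≤ D₁
      D₁≥1 = proj₁ (factors-pos D₁ q D≥1)
      D₁<D : D₁ < D₁ * q
      D₁<D = ℕP.m<m*n D₁ q {{ℕ.>-nonZero D₁≥1}} q>1
    ... | f , D′ , D₁≡ , q∤D′ =
      suc f , D′ , trans (ℕP.*-comm D₁ q) (trans (cong (q *_) D₁≡) (sym (ℕP.*-assoc q (q ^ f) D′))) , q∤D′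

  prime-power-witness : ∀ b → 1 ≤ b → ∀ D → ¬ (b ∣ D) → ∃[ q ] ∃[ e ] (Prime q × q ^ e ∣ b × ¬ (q ^ e ∣ D))
  prime-power-witness b b≥1 D b∤D = go b b≥1 b∤D (<-wellFounded b)
    where
    go : ∀ b → 1 ≤ b → ¬ (b ∣ D) → Acc _<_ b → ∃[ q ] ∃[ e ] (Prime q × q ^ e ∣ b × ¬ (q ^ e ∣ D))
    go (suc zero) _ b∤D _ = ⊥-elim (b∤D (ℕ∣.1∣ D))
    go b@(suc (suc _)) b≥1 b∤D (acc smaller) with prime-divisor b (s≤s (s≤s z≤n))
    ... | q , pq , q∣b with valuation q (prime>1 pq) b b≥1
    ... | e , b′ , b≡ , q∤b′ with q ^ e ∣? D
    ...   | no qᵉ∤D = q , e , pq , divides b′ (trans b≡ (ℕP.*-comm _ b′)) , qᵉ∤D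
    ...   | yes qᵉ∣D = lift (go b′ b′≥1 b′∤D (smaller b′<b))
      where
      -- b = qᵉ b′ with qᵉ ∣ D, so b′ ∤ D, and b′ < b since e ≥ 1
      lift : ∃[ r ] ∃[ k ] (Prime r × r ^ k ∣ b′ × ¬ (r ^ k ∣ D)) → ∃[ r ] ∃[ k ] (Prime r × r ^ k ∣ b × ¬ (r ^ k ∣ D))
      lift (r , k , pr , rᵏ∣b′ , rᵏ∤D) = r , k , pr , ℕ∣.∣-trans rᵏ∣b′ (divides (q ^ e) b≡) , rᵏ∤D
      b′≥1 : 1 ≤ b′
      b′≥1 = proj₂ (factors-pos (q ^ e) b′ (subst (1 ≤_) b≡ b≥1))
      e≥1 : 1 ≤ e
      e≥1 = positive e b≡
        where
        positive : ∀ e → b ≡ q ^ e * b′ → 1 ≤ e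
        positive zero b≡b′ = ⊥-elim (q∤b′ (subst (q ∣_) (trans b≡b′ (ℕP.+-identityʳ b′)) q∣b))
        positive (suc _) _ = s≤s z≤n
      b′<b : b′ < b
      b′<b = subst (b′ <_) (trans (ℕP.*-comm b′ _) (sym b≡)) (ℕP.m<m*n b′ (q ^ e) {{ℕ.>-nonZero b′≥1}} (ℕP.^-monoʳ-< q (prime>1 pq) e≥1))
      b′∤D : ¬ (b′ ∣ D)
      b′∤D b′∣D = b∤D (subst (_∣ D) (sym b≡) (coprime-∣-* (coprime-^ˡ e (prime-coprime pq q∤b′)) qᵉ∣D b′∣D))

  pigeonhole-ℕ : ∀ K (f : ℕ → ℕ) → (∀ i → f i < K) → ∃[ i ] ∃[ j ] (i < j × j ≤ K × f i ≡ f j)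
  pigeonhole-ℕ K f f<K with pigeonhole (ℕP.n<1+n K) (λ i → fromℕ< (f<K (toℕ i)))
  ... | i , j , i<j , slots≡ = toℕ i , toℕ j , i<j , ℕP.≤-pred (toℕ<n j) ,
    trans (sym (toℕ-fromℕ< (f<K (toℕ i)))) (trans (cong toℕ slots≡) (toℕ-fromℕ< (f<K (toℕ j))))

module IntegerDivisibility where

  open import Data.Nat as ℕ using (ℕ)
  open import Data.Nat.Divisibility as ℕ∣ using ()
  open import Data.Nat.Coprimality as Coprimality using (Coprime)
  open import Data.Nat.Primality using (Prime; euclidsLemma)
  open import Data.Integer using (ℤ; +_; _*_; _-_; ∣_∣)
  import Data.Integer.Properties as ℤP
  import Data.Integer.Divisibility.Signed as ℤ∣
  open ℤ∣ public using () renaming (_∣_ to _∣ℤ_)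
  open import Data.Integer.Tactic.RingSolver using (solve-∀)
  open import Data.Sum using (_⊎_; inj₁; inj₂)
  open import Relation.Nullary using (¬_; Dec; yes; no)
  open import Relation.Binary.PropositionalEquality using (_≡_; subst)
  open NatFacts using (coprime-^ˡ; prime-coprime)

  -- The algebraic identity behind "d ∣ a and d ∣ a - b imply d ∣ b".
  a-[a-b]≡b : ∀ a b → a - (a - b) ≡ b
  a-[a-b]≡b = solve-∀

  ∣ℤ⇒∣ : ∀ {d} a → + d ∣ℤ a → d ℕ∣.∣ ∣ a ∣
  ∣ℤ⇒∣ {d} a = ℤ∣.∣⇒∣ᵤ {+ d} {a}

  ∣⇒∣ℤ : ∀ {d} a → d ℕ∣.∣ ∣ a ∣ → + d ∣ℤ a
  ∣⇒∣ℤ {d} a = ℤ∣.∣ᵤ⇒∣ {+ d} {a}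

  _∣ℤ?_ : ∀ d a → Dec (+ d ∣ℤ a)
  d ∣ℤ? a with d ℕ∣.∣? ∣ a ∣
  ... | yes d∣a = yes (∣⇒∣ℤ a d∣a)
  ... | no d∤a = no (λ d∣a → d∤a (∣ℤ⇒∣ a d∣a))

  euclidℤ : ∀ {p} → Prime p → ∀ a b → + p ∣ℤ a * b → + p ∣ℤ a ⊎ + p ∣ℤ b
  euclidℤ {p} pp a b p∣ab with euclidsLemma ∣ a ∣ ∣ b ∣ pp (subst (p ℕ∣.∣_) (ℤP.abs-* a b) (∣ℤ⇒∣ (a * b) p∣ab))
  ... | inj₁ p∣a = inj₁ (∣⇒∣ℤ a p∣a)
  ... | inj₂ p∣b = inj₂ (∣⇒∣ℤ b p∣b)

  prime-power-cancel : ∀ {p} k → Prime p → ∀ a b → + (p ℕ.^ k) ∣ℤ a * b → ¬ (+ p ∣ℤ a) → + (p ℕ.^ k) ∣ℤ b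
  prime-power-cancel {p} k pp a b pᵏ∣ab p∤a =
    ∣⇒∣ℤ b (Coprimality.coprime-divisor coprime (subst (p ℕ.^ k ℕ∣.∣_) (ℤP.abs-* a b) (∣ℤ⇒∣ (a * b) pᵏ∣ab)))
    where
    coprime : Coprime (p ℕ.^ k) ∣ a ∣
    coprime = coprime-^ˡ k (prime-coprime pp (λ p∣a → p∤a (∣⇒∣ℤ a p∣a)))

module Congruence where

  open import Data.Nat as ℕ using (ℕ; zero; suc)
  import Data.Nat.Divisibility as ℕ∣
  open import Data.Nat.Coprimality as Coprimality using (Coprime; coprime-Bézout)
  open import Data.Nat.GCD using (module Bézout)
  open import Data.Integer using (ℤ; +_; _+_; _*_; _-_; -_; _^_)
  import Data.Integer.Properties as ℤP
  import Data.Integer.DivMod as ℤDivMod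
  import Data.Integer.Divisibility.Signed as ℤ∣
  open import Data.Integer.Tactic.RingSolver using (solve-∀; solve)
  open import Data.List using (_∷_; [])
  open import Data.Product using (∃-syntax; _×_; _,_)
  open import Level using (0ℓ)
  open import Relation.Nullary using (Dec; yes; no)
  open import Relation.Binary.Bundles using (Setoid)
  open import Relation.Binary.Structures using (IsEquivalence)
  open import Relation.Binary.PropositionalEquality using (_≡_; refl; sym; trans; cong; subst)
  import Relation.Binary.Reasoning.Setoid as SetoidReasoning
  open import Defs using (CoprimeTo)
  open NatFacts
  open IntegerDivisibility

  -- Congruence modulo N.  It is a record so that the modulus N can be inferred.
  infix 4 _≋_[_]
  record _≋_[_] (a b : ℤ) (N : ℕ) : Set where
    constructor mk≋
    field N∣a-b : + N ∣ℤ a - b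
  open _≋_[_] public

  ≋-by : ∀ {N a b} X → a - b ≡ X → + N ∣ℤ X → a ≋ b [ N ]
  ≋-by X eq N∣X = mk≋ (subst (_ ∣ℤ_) (sym eq) N∣X)

  ≋-refl : ∀ {N} a → a ≋ a [ N ]
  ≋-refl a = ≋-by (+ 0) (ℤP.+-inverseʳ a) (ℤ∣.divides (+ 0) refl)

  ≋-reflexive : ∀ {N a b} → a ≡ b → a ≋ b [ N ]
  ≋-reflexive {a = a} refl = ≋-refl a

  ≋-sym : ∀ {N a b} → a ≋ b [ N ] → b ≋ a [ N ]
  ≋-sym {a = a} {b} e = ≋-by (- (a - b)) (solve (a ∷ b ∷ [])) (ℤ∣.∣m⇒∣-m (N∣a-b e))

  ≋-trans : ∀ {N a b c} → a ≋ b [ N ] → b ≋ c [ N ] → a ≋ c [ N ]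
  ≋-trans {a = a} {b} {c} e f = ≋-by ((a - b) + (b - c)) (solve (a ∷ b ∷ c ∷ [])) (ℤ∣.∣m∣n⇒∣m+n (N∣a-b e) (N∣a-b f))

  ≋-isEquivalence : ∀ N → IsEquivalence (λ a b → a ≋ b [ N ])
  ≋-isEquivalence N = record { refl = ≋-refl _ ; sym = ≋-sym ; trans = ≋-trans }

  ≋-setoid : ℕ → Setoid 0ℓ 0ℓ
  ≋-setoid N = record { isEquivalence = ≋-isEquivalence N }

  module ≋-Reasoning (N : ℕ) = SetoidReasoning (≋-setoid N)

  ≋-+ : ∀ {N a b c d} → a ≋ b [ N ] → c ≋ d [ N ] → a + c ≋ b + d [ N ]
  ≋-+ {a = a} {b} {c} {d} e f =
    ≋-by ((a - b) + (c - d)) (solve (a ∷ b ∷ c ∷ d ∷ [])) (ℤ∣.∣m∣n⇒∣m+n (N∣a-b e) (N∣a-b f))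

  ≋-neg : ∀ {N a b} → a ≋ b [ N ] → - a ≋ - b [ N ]
  ≋-neg {a = a} {b} e = ≋-by (- (a - b)) (solve (a ∷ b ∷ [])) (ℤ∣.∣m⇒∣-m (N∣a-b e))

  ≋-* : ∀ {N a b c d} → a ≋ b [ N ] → c ≋ d [ N ] → a * c ≋ b * d [ N ]
  ≋-* {a = a} {b} {c} {d} e f = ≋-by (a * (c - d) + (a - b) * d) (solve (a ∷ b ∷ c ∷ d ∷ []))
    (ℤ∣.∣m∣n⇒∣m+n (ℤ∣.∣n⇒∣m*n a (N∣a-b f)) (ℤ∣.∣m⇒∣m*n d (N∣a-b e)))

  ≋-*ˡ : ∀ {N a b} c → a ≋ b [ N ] → c * a ≋ c * b [ N ]
  ≋-*ˡ c = ≋-* (≋-refl c)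

  ≋-*ʳ : ∀ {N a b} c → a ≋ b [ N ] → a * c ≋ b * c [ N ]
  ≋-*ʳ c e = ≋-* e (≋-refl c)

  ≋-^ : ∀ {N a b} k → a ≋ b [ N ] → a ^ k ≋ b ^ k [ N ]
  ≋-^ zero e = ≋-refl _
  ≋-^ (suc k) e = ≋-* e (≋-^ k e)

  ≋-weaken : ∀ {M N a b} → M ℕ∣.∣ N → a ≋ b [ N ] → a ≋ b [ M ]
  ≋-weaken {M} {N} M∣N e = mk≋ (ℤ∣.∣-trans (ℤ∣.∣ᵤ⇒∣ {+ M} {+ N} M∣N) (N∣a-b e))

  ≋? : ∀ N a b → Dec (a ≋ b [ N ])
  ≋? N a b with N ∣ℤ? (a - b)
  ... | yes N∣a-b = yes (mk≋ N∣a-b)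
  ... | no N∤a-b = no (λ e → N∤a-b (N∣a-b e))

  ≋-join : ∀ {P Q a b} → Coprime P Q → a ≋ b [ P ] → a ≋ b [ Q ] → a ≋ b [ P ℕ.* Q ]
  ≋-join {a = a} {b} c e f =
    mk≋ (∣⇒∣ℤ (a - b) (coprime-∣-* c (∣ℤ⇒∣ (a - b) (N∣a-b e)) (∣ℤ⇒∣ (a - b) (N∣a-b f))))

  bézout-idempotent : ∀ {A B} x y → 1 ℕ.+ y ℕ.* B ≡ x ℕ.* A → + (x ℕ.* A) ≋ + 0 [ A ] × + (x ℕ.* A) ≋ + 1 [ B ]
  bézout-idempotent {A} {B} x y 1+yB≡xA =
      ≋-by (+ x * + A) (trans (ℤP.+-identityʳ _) (ℤP.pos-* x A)) (ℤ∣.∣n⇒∣m*n (+ x) ℤ∣.∣-refl)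
    , ≋-by (+ y * + B) xA-1≡yB (ℤ∣.∣n⇒∣m*n (+ y) ℤ∣.∣-refl)
    where
    xA-1≡yB : + (x ℕ.* A) - + 1 ≡ + y * + B
    xA-1≡yB = trans (cong (λ k → + k - + 1) (sym 1+yB≡xA))
                (trans (cong (_- + 1) (trans (ℤP.pos-+ 1 (y ℕ.* B)) (cong (λ k → + 1 + k) (ℤP.pos-* y B))))
                       (1+k-1≡k (+ y * + B)))
      where 1+k-1≡k : ∀ k → + 1 + k - + 1 ≡ k
            1+k-1≡k = solve-∀

  idempotent-combine : ∀ {A B e} → e ≋ + 1 [ A ] → e ≋ + 0 [ B ] → ∀ a b →
                       a * e + b * (+ 1 - e) ≋ a [ A ] × a * e + b * (+ 1 - e) ≋ b [ B ]
  idempotent-combine {A} {B} {e} e≋1 e≋0 a b =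
      ≋-by ((b - a) * (+ 1 - e)) (solve (a ∷ b ∷ e ∷ [])) (ℤ∣.∣n⇒∣m*n (b - a) A∣1-e)
    , ≋-by ((a - b) * e) (solve (a ∷ b ∷ e ∷ [])) (ℤ∣.∣n⇒∣m*n (a - b) (subst (_ ∣ℤ_) (ℤP.+-identityʳ e) (N∣a-b e≋0)))
    where
    A∣1-e : + A ∣ℤ + 1 - e
    A∣1-e = subst (_ ∣ℤ_) (negate e) (ℤ∣.∣m⇒∣-m (N∣a-b e≋1))
      where negate : ∀ e → - (e - + 1) ≡ + 1 - e
            negate = solve-∀

  crt : ∀ {P Q} → Coprime P Q → ∀ a b → ∃[ z ] (z ≋ a [ P ] × z ≋ b [ Q ])
  crt c a b with coprime-Bézout c
  ... | Bézout.+- x y 1+yQ≡xP with bézout-idempotent x y 1+yQ≡xP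
  ...   | e≋0 , e≋1 with idempotent-combine e≋1 e≋0 b a
  ...     | z≋b , z≋a = _ , z≋a , z≋b
  crt c a b | Bézout.-+ x y 1+xP≡yQ with bézout-idempotent y x 1+xP≡yQ
  ...   | e≋0 , e≋1 = _ , idempotent-combine e≋1 e≋0 a b

  coprime-≋ : ∀ {n a b} → a ≋ b [ n ] → CoprimeTo n b → CoprimeTo n a
  coprime-≋ {n} {a} {b} e cb {d} (d∣a , d∣n) = cb (∣ℤ⇒∣ b d∣b , d∣n)
    where
    d∣a-b : + d ∣ℤ a - b
    d∣a-b = ℤ∣.∣-trans (ℤ∣.∣ᵤ⇒∣ {+ d} {+ n} d∣n) (N∣a-b e)
    d∣b : + d ∣ℤ b
    d∣b = subst (_ ∣ℤ_) (a-[a-b]≡b a b) (ℤ∣.∣m∣n⇒∣m-n (∣⇒∣ℤ a d∣a) d∣a-b)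

  coprime-neg : ∀ {n a} → CoprimeTo n a → CoprimeTo n (- a)
  coprime-neg {a = a} c rewrite ℤP.∣-i∣≡∣i∣ a = c

  coprime-1 : ∀ {n} → CoprimeTo n (+ 1)
  coprime-1 (d∣1 , _) = ℕ∣.∣1⇒≡1 d∣1

  coprime-* : ∀ {n a b} → CoprimeTo n a → CoprimeTo n b → CoprimeTo n (a * b)
  coprime-* {a = a} {b} ca cb rewrite ℤP.abs-* a b = coprime-*ˡ ca cb

  coprime-^ : ∀ {n a} k → CoprimeTo n a → CoprimeTo n (a ^ k)
  coprime-^ zero c = coprime-1
  coprime-^ {n} {a} (suc k) c = coprime-* {n} {a} c (coprime-^ {n} k c)

  coprime-split : ∀ {P Q} a → CoprimeTo (P ℕ.* Q) a → CoprimeTo P a × CoprimeTo Q a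
  coprime-split {P} {Q} a c = (λ (d∣a , d∣P) → c (d∣a , ℕ∣.∣-trans d∣P (ℕ∣.m∣m*n Q)))
                            , (λ (d∣a , d∣Q) → c (d∣a , ℕ∣.∣-trans d∣Q (ℕ∣.n∣m*n P)))

  coprime-join : ∀ {P Q} a → CoprimeTo P a → CoprimeTo Q a → CoprimeTo (P ℕ.* Q) a
  coprime-join a cP cQ = Coprimality.sym (coprime-*ˡ (Coprimality.sym cP) (Coprimality.sym cQ))

  power≋1⇒coprime : ∀ {N} x T → 1 ℕ.≤ T → x ^ T ≋ + 1 [ N ] → CoprimeTo N x
  power≋1⇒coprime {N} x (suc T) _ e {d} (d∣x , d∣N) = ℕ∣.∣1⇒≡1 (∣ℤ⇒∣ (+ 1) d∣1)
    where
    d∣xᵀ⁺¹ : + d ∣ℤ x ^ suc T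
    d∣xᵀ⁺¹ = ℤ∣.∣m⇒∣m*n (x ^ T) (∣⇒∣ℤ x d∣x)
    d∣xᵀ⁺¹-1 : + d ∣ℤ x ^ suc T - + 1
    d∣xᵀ⁺¹-1 = ℤ∣.∣-trans (ℤ∣.∣ᵤ⇒∣ {+ d} {+ N} d∣N) (N∣a-b e)
    d∣1 : + d ∣ℤ + 1
    d∣1 = subst (_ ∣ℤ_) (a-[a-b]≡b (x ^ suc T) (+ 1)) (ℤ∣.∣m∣n⇒∣m-n d∣xᵀ⁺¹ d∣xᵀ⁺¹-1)

  -- The least non-negative residue of a modulo N > 0.  Only the properties below are
  -- ever used; keeping the definition abstract stops the type checker from unfolding
  -- integer division, which is very slow.
  module _ (N : ℕ) .{{_ : ℕ.NonZero N}} where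
   abstract
    residue : ℤ → ℕ
    residue a = a ℤDivMod.%ℕ N

    residue<N : ∀ a → residue a ℕ.< N
    residue<N a = ℤDivMod.n%ℕd<d a N

    ≋residue : ∀ a → a ≋ + residue a [ N ]
    ≋residue a = ≋-by ((a ℤDivMod./ℕ N) * + N) a-r≡ (ℤ∣.∣n⇒∣m*n (a ℤDivMod./ℕ N) ℤ∣.∣-refl)
      where
      a-r≡ : a - + residue a ≡ (a ℤDivMod./ℕ N) * + N
      a-r≡ = trans (cong (_- + residue a) (ℤDivMod.a≡a%ℕn+[a/ℕn]*n a N)) (r+m-r≡m (+ residue a) _)
        where r+m-r≡m : ∀ r m → r + m - r ≡ m
              r+m-r≡m = solve-∀


   residue-≡⇒≋ : ∀ a b → residue a ≡ residue b → a ≋ b [ N ]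
   residue-≡⇒≋ a b r≡r = ≋-trans (≋residue a) (≋-trans (≋-reflexive (cong +_ r≡r)) (≋-sym (≋residue b)))

module StarCongruence where

  open import Data.Nat using (ℕ; zero; suc)
  open import Data.Integer using (ℤ; +_; _+_; _*_; _-_; -_; _^_)
  import Data.Integer.Properties as ℤP
  import Data.Integer.Divisibility.Signed as ℤ∣
  open import Data.Integer.Tactic.RingSolver using (solve-∀)
  open import Data.Sum using (_⊎_; inj₁; inj₂)
  open import Level using (0ℓ)
  open import Relation.Binary.Bundles using (Setoid)
  open import Relation.Binary.Structures using (IsEquivalence)
  open import Relation.Binary.PropositionalEquality using (_≡_; refl; sym; trans; subst)
  import Relation.Binary.Reasoning.Setoid as SetoidReasoning
  open import Defs using (CoprimeTo; _≡⋆_[mod_])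
  open IntegerDivisibility
  open Congruence

  -- The relation  a ≡ ±b (mod n)  defining G⋆ₙ, i.e. _≡⋆_[mod_] restated through ≋
  -- (so that n can be inferred and the congruence lemmas apply).
  infix 4 _∼_[_]
  record _∼_[_] (a b : ℤ) (n : ℕ) : Set where
    constructor mk∼
    field ≋± : a ≋ b [ n ] ⊎ a ≋ - b [ n ]
  open _∼_[_] public

  a+b≡a--b : ∀ a b → a + b ≡ a - - b
  a+b≡a--b = solve-∀

  ⋆⇒∼ : ∀ {n} a b → a ≡⋆ b [mod n ] → a ∼ b [ n ]
  ⋆⇒∼ a b (inj₁ n∣a-b) = mk∼ (inj₁ (mk≋ (ℤ∣.∣ᵤ⇒∣ n∣a-b)))
  ⋆⇒∼ a b (inj₂ n∣a+b) = mk∼ (inj₂ (mk≋ (subst (_ ∣ℤ_) (a+b≡a--b a b) (ℤ∣.∣ᵤ⇒∣ n∣a+b))))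

  ∼⇒⋆ : ∀ {n} a b → a ∼ b [ n ] → a ≡⋆ b [mod n ]
  ∼⇒⋆ a b (mk∼ (inj₁ e)) = inj₁ (ℤ∣.∣⇒∣ᵤ (N∣a-b e))
  ∼⇒⋆ a b (mk∼ (inj₂ e)) = inj₂ (ℤ∣.∣⇒∣ᵤ (subst (_ ∣ℤ_) (sym (a+b≡a--b a b)) (N∣a-b e)))

  ∼-refl : ∀ {n} a → a ∼ a [ n ]
  ∼-refl a = mk∼ (inj₁ (≋-refl a))

  ∼-reflexive : ∀ {n a b} → a ≡ b → a ∼ b [ n ]
  ∼-reflexive refl = ∼-refl _

  ≋⇒∼ : ∀ {n a b} → a ≋ b [ n ] → a ∼ b [ n ]
  ≋⇒∼ e = mk∼ (inj₁ e)

  ≋-neg-swap : ∀ {n a b} → a ≋ - b [ n ] → - a ≋ b [ n ]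
  ≋-neg-swap {b = b} e = ≋-trans (≋-neg e) (≋-reflexive (ℤP.neg-involutive b))

  ∼-sym : ∀ {n a b} → a ∼ b [ n ] → b ∼ a [ n ]
  ∼-sym (mk∼ (inj₁ e)) = mk∼ (inj₁ (≋-sym e))
  ∼-sym (mk∼ (inj₂ e)) = mk∼ (inj₂ (≋-sym (≋-neg-swap e)))

  ∼-trans : ∀ {n a b c} → a ∼ b [ n ] → b ∼ c [ n ] → a ∼ c [ n ]
  ∼-trans (mk∼ (inj₁ e)) (mk∼ (inj₁ f)) = mk∼ (inj₁ (≋-trans e f))
  ∼-trans (mk∼ (inj₁ e)) (mk∼ (inj₂ f)) = mk∼ (inj₂ (≋-trans e f))
  ∼-trans (mk∼ (inj₂ e)) (mk∼ (inj₁ f)) = mk∼ (inj₂ (≋-trans e (≋-neg f)))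
  ∼-trans (mk∼ (inj₂ e)) (mk∼ (inj₂ f)) = mk∼ (inj₁ (≋-trans e (≋-neg-swap f)))

  ∼-isEquivalence : ∀ n → IsEquivalence (λ a b → a ∼ b [ n ])
  ∼-isEquivalence n = record { refl = ∼-refl _ ; sym = ∼-sym ; trans = ∼-trans }

  ∼-setoid : ℕ → Setoid 0ℓ 0ℓ
  ∼-setoid n = record { isEquivalence = ∼-isEquivalence n }

  module ∼-Reasoning (n : ℕ) = SetoidReasoning (∼-setoid n)

  b*-d≡-[b*d] : ∀ b d → b * - d ≡ - (b * d)
  b*-d≡-[b*d] = solve-∀

  -b*d≡-[b*d] : ∀ b d → - b * d ≡ - (b * d)
  -b*d≡-[b*d] = solve-∀

  -b*-d≡b*d : ∀ b d → - b * - d ≡ b * d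
  -b*-d≡b*d = solve-∀

  ∼-* : ∀ {n a b c d} → a ∼ b [ n ] → c ∼ d [ n ] → a * c ∼ b * d [ n ]
  ∼-* (mk∼ (inj₁ e)) (mk∼ (inj₁ f)) = mk∼ (inj₁ (≋-* e f))
  ∼-* {b = b} {d = d} (mk∼ (inj₁ e)) (mk∼ (inj₂ f)) = mk∼ (inj₂ (≋-trans (≋-* e f) (≋-reflexive (b*-d≡-[b*d] b d))))
  ∼-* {b = b} {d = d} (mk∼ (inj₂ e)) (mk∼ (inj₁ f)) = mk∼ (inj₂ (≋-trans (≋-* e f) (≋-reflexive (-b*d≡-[b*d] b d))))
  ∼-* {b = b} {d = d} (mk∼ (inj₂ e)) (mk∼ (inj₂ f)) = mk∼ (inj₁ (≋-trans (≋-* e f) (≋-reflexive (-b*-d≡b*d b d))))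

  ∼-^ : ∀ {n a b} k → a ∼ b [ n ] → a ^ k ∼ b ^ k [ n ]
  ∼-^ zero e = ∼-refl _
  ∼-^ (suc k) e = ∼-* e (∼-^ k e)

  ∼1-^ : ∀ {n a} k → a ∼ + 1 [ n ] → a ^ k ∼ + 1 [ n ]
  ∼1-^ k e = ∼-trans (∼-^ k e) (∼-reflexive (ℤP.^-zeroˡ k))

  ∼1⇒square≋1 : ∀ {n a} → a ∼ + 1 [ n ] → a * a ≋ + 1 [ n ]
  ∼1⇒square≋1 (mk∼ (inj₁ e)) = ≋-* e e
  ∼1⇒square≋1 (mk∼ (inj₂ e)) = ≋-* e e

  coprime-∼ : ∀ {n a b} → a ∼ b [ n ] → CoprimeTo n b → CoprimeTo n a
  coprime-∼ (mk∼ (inj₁ e)) cb = coprime-≋ e cb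
  coprime-∼ {n} {b = b} (mk∼ (inj₂ e)) cb = coprime-≋ e (coprime-neg {n} {b} cb)

module Orders where

  open import Data.Nat as ℕ using (ℕ; zero; suc; _≤_; _<_; z≤n; s≤s; _%_; _/_)
  import Data.Nat.Properties as ℕP
  open import Data.Nat.Divisibility as ℕ∣ using (_∣_; divides)
  open import Data.Nat.DivMod using (m≡m%n+[m/n]*n; m%n<n)
  open import Data.Nat.Coprimality using (Coprime; coprime-divisor)
  import Data.Nat.Coprimality as Coprimality
  open import Data.Integer as ℤ using (ℤ; +_; _*_; _-_; _^_)
  import Data.Integer.Properties as ℤP
  open import Data.Integer.Tactic.RingSolver using (solve-∀)
  open import Data.Empty using (⊥-elim)
  open import Data.Product using (Σ; ∃-syntax; _×_; _,_; proj₁; proj₂)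
  open import Data.Sum using (_⊎_; inj₁; inj₂; [_,_]′)
  open import Relation.Nullary using (¬_; Dec; yes; no)
  open import Relation.Binary.PropositionalEquality using (_≡_; refl; sym; trans; cong; subst)
  open NatFacts
  open IntegerDivisibility
  open Congruence

  ^-distribʳ-* : ∀ x y k → (x * y) ^ k ≡ x ^ k * y ^ k
  ^-distribʳ-* x y zero = refl
  ^-distribʳ-* x y (suc k) = trans (cong ((x * y) *_) (^-distribʳ-* x y k)) (interchange x y (x ^ k) (y ^ k))
    where interchange : ∀ a b c d → a * b * (c * d) ≡ a * c * (b * d)
          interchange = solve-∀

  power≋1-* : ∀ {N x} a → x ^ a ≋ + 1 [ N ] → ∀ t → x ^ (a ℕ.* t) ≋ + 1 [ N ]
  power≋1-* {x = x} a e t = ≋-trans (≋-reflexive (sym (ℤP.^-*-assoc x a t))) (≋-trans (≋-^ t e) (≋-reflexive (ℤP.^-zeroˡ t)))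

  power≋1-∣ : ∀ {N x a k} → x ^ a ≋ + 1 [ N ] → a ∣ k → x ^ k ≋ + 1 [ N ]
  power≋1-∣ {N} {x} {a} e (divides t refl) = subst (λ k → x ^ k ≋ + 1 [ N ]) (ℕP.*-comm a t) (power≋1-* a e t)

  power-period : ∀ {N} x T → x ^ T ≋ + 1 [ N ] → ∀ i s → x ^ (i ℕ.+ T ℕ.* s) ≋ x ^ i [ N ]
  power-period x T e i s = ≋-trans (≋-reflexive (ℤP.^-distribˡ-+-* x i (T ℕ.* s)))
    (≋-trans (≋-*ˡ (x ^ i) (power≋1-* T e s)) (≋-reflexive (ℤP.*-identityʳ (x ^ i))))

  record Order (N : ℕ) (x : ℤ) (d : ℕ) : Set where
    constructor order
    field
      positive : 1 ≤ d
      kills    : x ^ d ≋ + 1 [ N ]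
      minimal  : ∀ k → x ^ k ≋ + 1 [ N ] → d ∣ k
  open Order public

  Order-resp : ∀ {N x y d} → x ≋ y [ N ] → Order N x d → Order N y d
  Order-resp {d = d} x≋y (order d≥1 xᵈ≋1 min) =
    order d≥1 (≋-trans (≋-^ d (≋-sym x≋y)) xᵈ≋1) (λ k yᵏ≋1 → min k (≋-trans (≋-^ k x≋y) yᵏ≋1))

  Order-unique : ∀ {N x d d′} → Order N x d → Order N x d′ → d ≡ d′
  Order-unique o o′ = ℕ∣.∣-antisym (minimal o _ (kills o′)) (minimal o′ _ (kills o))

  Order-^ : ∀ {N x d} k e → Order N x d → d ≡ k ℕ.* e → Order N (x ^ k) e
  Order-^ {N} {x} k e (order d≥1 xᵈ≋1 min) refl = order e≥1 xᵏᵉ≋1 min′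
    where
    k≥1 : 1 ≤ k
    k≥1 = proj₁ (factors-pos k e d≥1)
    e≥1 : 1 ≤ e
    e≥1 = proj₂ (factors-pos k e d≥1)
    xᵏᵉ≋1 : (x ^ k) ^ e ≋ + 1 [ N ]
    xᵏᵉ≋1 = ≋-trans (≋-reflexive (ℤP.^-*-assoc x k e)) xᵈ≋1
    min′ : ∀ j → (x ^ k) ^ j ≋ + 1 [ N ] → e ∣ j
    min′ j e′ = ℕ∣.*-cancelˡ-∣ k {{ℕ.>-nonZero k≥1}} (min (k ℕ.* j) (≋-trans (≋-reflexive (sym (ℤP.^-*-assoc x k j))) e′))

  Order-* : ∀ {N x y a b} → Order N x a → Order N y b → Coprime a b → Order N (x * y) (a ℕ.* b)
  Order-* {N} {x} {y} {a} {b} (order a≥1 xᵃ≋1 minx) (order b≥1 yᵇ≋1 miny) a⊥b =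
    order (ℕP.*-mono-≤ a≥1 b≥1) [xy]ᵃᵇ≋1 min
    where
    xᵃᵇ≋1 : ∀ t → x ^ (a ℕ.* t) ≋ + 1 [ N ]
    xᵃᵇ≋1 = power≋1-* a xᵃ≋1
    yᵗᵇ≋1 : ∀ t → y ^ (t ℕ.* b) ≋ + 1 [ N ]
    yᵗᵇ≋1 t = subst (λ k → y ^ k ≋ + 1 [ N ]) (ℕP.*-comm b t) (power≋1-* b yᵇ≋1 t)
    [xy]ᵃᵇ≋1 : (x * y) ^ (a ℕ.* b) ≋ + 1 [ N ]
    [xy]ᵃᵇ≋1 = ≋-trans (≋-reflexive (^-distribʳ-* x y (a ℕ.* b))) (≋-* (xᵃᵇ≋1 b) (yᵗᵇ≋1 a))
    -- raising (xy)ᵏ ≡ 1 to the power b kills y and leaves x^(kb) ≡ 1, so a ∣ kb, so a ∣ k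
    a∣k : ∀ k → (x * y) ^ k ≋ + 1 [ N ] → a ∣ k
    a∣k k e = coprime-divisor a⊥b (subst (a ∣_) (ℕP.*-comm k b) (minx (k ℕ.* b) xᵏᵇ≋1))
      where
      xᵏᵇ≋1 : x ^ (k ℕ.* b) ≋ + 1 [ N ]
      xᵏᵇ≋1 = ≋-trans (≋-sym (≋-trans (≋-*ˡ (x ^ (k ℕ.* b)) (yᵗᵇ≋1 k)) (≋-reflexive (ℤP.*-identityʳ _))))
                (≋-trans (≋-reflexive (sym (^-distribʳ-* x y (k ℕ.* b)))) (power≋1-* k e b))
    b∣k : ∀ k → (x * y) ^ k ≋ + 1 [ N ] → b ∣ k
    b∣k k e = coprime-divisor (Coprimality.sym a⊥b) (subst (b ∣_) (ℕP.*-comm k a) (miny (k ℕ.* a) yᵏᵃ≋1))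
      where
      yᵏᵃ≋1 : y ^ (k ℕ.* a) ≋ + 1 [ N ]
      yᵏᵃ≋1 = ≋-trans (≋-sym (≋-trans (≋-*ʳ (y ^ (k ℕ.* a)) (subst (λ j → x ^ j ≋ + 1 [ N ]) (ℕP.*-comm a k) (xᵃᵇ≋1 k)))
                                     (≋-reflexive (ℤP.*-identityˡ _))))
                (≋-trans (≋-reflexive (sym (^-distribʳ-* x y (k ℕ.* a)))) (power≋1-* k e a))
    min : ∀ k → (x * y) ^ k ≋ + 1 [ N ] → a ℕ.* b ∣ k
    min k e = coprime-∣-* a⊥b (a∣k k e) (b∣k k e)

  least : (P : ℕ → Set) → (∀ j → Dec (P j)) → ∀ K →
    (∃[ j ] (1 ≤ j × j ≤ K × P j × (∀ i → 1 ≤ i → i < j → ¬ P i))) ⊎ (∀ i → 1 ≤ i → i ≤ K → ¬ P i)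
  least P P? zero = inj₂ (λ i i≥1 i≤0 _ → ℕP.<-irrefl refl (ℕP.≤-trans i≥1 i≤0))
  least P P? (suc K) with least P P? K
  ... | inj₁ (j , j≥1 , j≤K , Pj , below) = inj₁ (j , j≥1 , ℕP.m≤n⇒m≤1+n j≤K , Pj , below)
  ... | inj₂ none with P? (suc K)
  ...   | yes PK = inj₁ (suc K , s≤s z≤n , ℕP.≤-refl , PK , λ i i≥1 i<sK → none i i≥1 (ℕP.≤-pred i<sK))
  ...   | no ¬PK = inj₂ λ i i≥1 i≤sK →
            [ (λ i<sK → none i i≥1 (ℕP.≤-pred i<sK)) , (λ { refl → ¬PK }) ]′ (ℕP.m≤n⇒m<n∨m≡n i≤sK)

  Order-exists : ∀ {N} x k → 1 ≤ k → x ^ k ≋ + 1 [ N ] → Σ ℕ λ d → Order N x d × d ≤ k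
  Order-exists {N} x k k≥1 xᵏ≋1 with least (λ j → x ^ j ≋ + 1 [ N ]) (λ j → ≋? N (x ^ j) (+ 1)) k
  ... | inj₂ none = ⊥-elim (none k k≥1 ℕP.≤-refl xᵏ≋1)
  ... | inj₁ (d , d≥1 , d≤k , xᵈ≋1 , below) = d , order d≥1 xᵈ≋1 min , d≤k
    where
    instance _ = ℕ.>-nonZero d≥1
    -- the remainder of j modulo d also kills x, so by minimality it is 0
    min : ∀ j → x ^ j ≋ + 1 [ N ] → d ∣ j
    min j xʲ≋1 with j % d | m≡m%n+[m/n]*n j d | m%n<n j d
    ... | zero | j≡ | _ = divides (j / d) j≡
    ... | suc r | j≡ | r<d = ⊥-elim (below (suc r) (s≤s z≤n) r<d xʳ≋1)
      where
      xʳ≋1 : x ^ suc r ≋ + 1 [ N ]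
      xʳ≋1 = ≋-trans (≋-sym (power-period x d xᵈ≋1 (suc r) (j / d)))
               (subst (λ i → x ^ i ≋ + 1 [ N ]) (trans j≡ (cong (suc r ℕ.+_) (ℕP.*-comm (j / d) d))) xʲ≋1)

  -- If g has order D and y has an order b not dividing D, then a product of powers of
  -- g and y has larger order: pick a prime power qᵉ ∣ b with qᵉ ∤ D, write D = q^f D′
  -- with q ∤ D′ (so f < e); then g^(q^f) has order D′, y^(b/qᵉ) has order qᵉ, and
  -- their product has order D′ qᵉ > D.
  larger-order : ∀ {N g y D b} → Order N g D → Order N y b → ¬ (b ∣ D) →
    ∃[ s ] ∃[ t ] ∃[ D⁺ ] (Order N (g ^ s * y ^ t) D⁺ × D < D⁺)
  larger-order {N} {g} {y} {D} {b} og oy b∤D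
    with prime-power-witness b (positive oy) D b∤D
  ... | q , e , pq , qᵉ∣b@(divides b′ b≡) , qᵉ∤D
    with valuation q (prime>1 pq) D (positive og)
  ... | f , D′ , D≡ , q∤D′ = q ℕ.^ f , b′ , D′ ℕ.* q ℕ.^ e , Order-* og′ oy′ D′⊥qᵉ , D<D′qᵉ
    where
    og′ : Order N (g ^ (q ℕ.^ f)) D′
    og′ = Order-^ (q ℕ.^ f) D′ og D≡
    oy′ : Order N (y ^ b′) (q ℕ.^ e)
    oy′ = Order-^ b′ (q ℕ.^ e) oy b≡
    D′⊥qᵉ : Coprime D′ (q ℕ.^ e)
    D′⊥qᵉ = Coprimality.sym (coprime-^ˡ e (prime-coprime pq q∤D′))
    f<e : f < e
    f<e = ℕP.≰⇒> (λ e≤f → qᵉ∤D (ℕ∣.∣-trans (^-∣-^ q e≤f) (divides D′ (trans D≡ (ℕP.*-comm _ D′)))))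
    D′≥1 : 1 ≤ D′
    D′≥1 = proj₂ (factors-pos (q ℕ.^ f) D′ (subst (1 ≤_) D≡ (positive og)))
    D<D′qᵉ : D < D′ ℕ.* q ℕ.^ e
    D<D′qᵉ = subst (_< D′ ℕ.* q ℕ.^ e) (trans (ℕP.*-comm D′ _) (sym D≡))
               (ℕP.*-monoʳ-< D′ {{ℕ.>-nonZero D′≥1}} (ℕP.^-monoʳ-< q (prime>1 pq) f<e))

  -- Powers x⁰, …, x^(T-1) of an element of order T are pairwise incongruent:
  -- from xⁱ ≡ x^(i+d), multiplying by x^(i(T-1)) gives x^d ≡ 1, so T ∣ d.
  Order-cancel : ∀ {N x T} → Order N x T → ∀ i d → x ^ i ≋ x ^ (i ℕ.+ d) [ N ] → x ^ d ≋ + 1 [ N ]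
  Order-cancel {N} {x} {suc T′} (order _ xᵀ≋1 _) i d e = ≋-sym (begin
    + 1                      ≈⟨ ≋-sym (power≋1-* (suc T′) xᵀ≋1 i) ⟩
    x ^ (suc T′ ℕ.* i)       ≡⟨ cong (x ^_) Ti≡ ⟩
    x ^ (t ℕ.+ i)            ≡⟨ ℤP.^-distribˡ-+-* x t i ⟩
    x ^ t * x ^ i            ≈⟨ ≋-*ˡ (x ^ t) e ⟩
    x ^ t * x ^ (i ℕ.+ d)    ≡⟨ cong (x ^ t *_) (ℤP.^-distribˡ-+-* x i d) ⟩
    x ^ t * (x ^ i * x ^ d)  ≡⟨ sym (ℤP.*-assoc (x ^ t) (x ^ i) (x ^ d)) ⟩
    x ^ t * x ^ i * x ^ d    ≡⟨ cong (_* x ^ d) (sym (trans (cong (x ^_) Ti≡) (ℤP.^-distribˡ-+-* x t i))) ⟩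
    x ^ (suc T′ ℕ.* i) * x ^ d ≈⟨ ≋-*ʳ (x ^ d) (power≋1-* (suc T′) xᵀ≋1 i) ⟩
    + 1 * x ^ d              ≡⟨ ℤP.*-identityˡ (x ^ d) ⟩
    x ^ d                    ∎)
    where
    open ≋-Reasoning N
    t = T′ ℕ.* i
    Ti≡ : suc T′ ℕ.* i ≡ t ℕ.+ i
    Ti≡ = ℕP.+-comm i t

  Order-distinct : ∀ {N x T} → Order N x T → ∀ {i j} → i < j → j < T → ¬ (x ^ i ≋ x ^ j [ N ])
  Order-distinct {N} {x} {T} o {i} {j} i<j j<T xⁱ≋xʲ =
    ℕP.<⇒≱ (ℕP.≤-<-trans (ℕP.m∸n≤m j i) j<T) (ℕ∣.∣⇒≤ {{ℕ.>-nonZero (ℕP.m<n⇒0<n∸m i<j)}} (minimal o (j ℕ.∸ i) xᵈ≋1))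
    where
    xᵈ≋1 : x ^ (j ℕ.∸ i) ≋ + 1 [ N ]
    xᵈ≋1 = Order-cancel o i (j ℕ.∸ i) (≋-trans xⁱ≋xʲ (≋-reflexive (cong (x ^_) (sym (ℕP.m+[n∸m]≡n (ℕP.<⇒≤ i<j))))))

  private
    power-≋-exponent-≤ : ∀ {N x T} → x ^ T ≋ + 1 [ N ] → ∀ {i j} → i ≤ j → + i ≋ + j [ T ] → x ^ j ≋ x ^ i [ N ]
    power-≋-exponent-≤ {N} {x} {T} xᵀ≋1 {i} {j} i≤j i≋j = from-divisor T∣j-i
      where
      T∣j-i : T ∣ j ℕ.∸ i
      T∣j-i = subst (T ∣_) (trans (cong ℤ.∣_∣ (ℤP.m-n≡m⊖n i j)) (ℤP.∣⊖∣-≤ i≤j)) (∣ℤ⇒∣ (+ i - + j) (N∣a-b i≋j))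
      from-divisor : T ∣ j ℕ.∸ i → x ^ j ≋ x ^ i [ N ]
      from-divisor (divides t j-i≡tT) =
        ≋-trans (≋-reflexive (cong (x ^_) j≡)) (power-period x T xᵀ≋1 i t)
        where j≡ : j ≡ i ℕ.+ T ℕ.* t
              j≡ = trans (sym (ℕP.m+[n∸m]≡n i≤j)) (cong (i ℕ.+_) (trans j-i≡tT (ℕP.*-comm t T)))

  power-≋-exponent : ∀ {N x T} → x ^ T ≋ + 1 [ N ] → ∀ {i j} → + i ≋ + j [ T ] → x ^ i ≋ x ^ j [ N ]
  power-≋-exponent xᵀ≋1 {i} {j} i≋j with ℕP.≤-total i j
  ... | inj₁ i≤j = ≋-sym (power-≋-exponent-≤ xᵀ≋1 i≤j i≋j)
  ... | inj₂ j≤i = power-≋-exponent-≤ xᵀ≋1 j≤i (≋-sym i≋j)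

module Totient where

  open import Data.Nat using (ℕ; zero; suc; _+_; _*_; _^_; _∸_; _≤_; _<_; z≤n; s≤s)
  import Data.Nat.Properties as ℕP
  open import Data.Nat.Divisibility as ℕ∣ using (_∣_; _∣?_; divides)
  open import Data.Nat.Coprimality using (Coprime; coprime?)
  import Data.Nat.Coprimality as Coprimality
  open import Data.Nat.Primality using (Prime)
  import Data.Nat.Tactic.RingSolver as ℕSolver
  open import Data.List using (_∷_; []; map; upTo; length; filter; _++_; _∷ʳ_)
  import Data.List.Properties as List
  open import Data.Empty using (⊥-elim)
  open import Data.Product using (_×_; _,_)
  open import Relation.Nullary using (¬_; yes; no)
  open import Relation.Nullary.Decidable using (_×-dec_; ¬?)
  open import Relation.Unary using (Decidable)
  open import Relation.Binary.PropositionalEquality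
    using (_≡_; _≢_; refl; sym; trans; cong; cong₂; subst; module ≡-Reasoning)
  open import Defs using (φ)
  open NatFacts

  count : {P : ℕ → Set} → Decidable P → ℕ → ℕ
  count P? zero = 0
  count P? (suc N) with P? (suc N)
  ... | yes _ = suc (count P? N)
  ... | no _ = count P? N

  filter≡count : {P : ℕ → Set} (P? : Decidable P) (N : ℕ) → length (filter P? (map suc (upTo N))) ≡ count P? N
  filter≡count P? zero = refl
  filter≡count P? (suc N) = begin
    length (filter P? (map suc (upTo (suc N))))
      ≡⟨ cong (λ xs → length (filter P? (map suc xs))) (sym (List.upTo-∷ʳ N)) ⟩
    length (filter P? (map suc (upTo N ∷ʳ N)))
      ≡⟨ cong (λ xs → length (filter P? xs)) (List.map-++ suc (upTo N) (N ∷ [])) ⟩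
    length (filter P? (map suc (upTo N) ++ (suc N ∷ [])))
      ≡⟨ cong length (List.filter-++ P? (map suc (upTo N)) (suc N ∷ [])) ⟩
    length (filter P? (map suc (upTo N)) ++ filter P? (suc N ∷ []))
      ≡⟨ List.length-++ (filter P? (map suc (upTo N))) ⟩
    length (filter P? (map suc (upTo N))) + length (filter P? (suc N ∷ []))
      ≡⟨ cong (_+ length (filter P? (suc N ∷ []))) (filter≡count P? N) ⟩
    count P? N + length (filter P? (suc N ∷ []))
      ≡⟨ last-step ⟩
    count P? (suc N) ∎
    where
    open ≡-Reasoning
    last-step : count P? N + length (filter P? (suc N ∷ [])) ≡ count P? (suc N)
    last-step with P? (suc N)
    ... | yes _ = ℕP.+-comm (count P? N) 1
    ... | no _ = ℕP.+-identityʳ (count P? N)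

  φ≡count : ∀ n → φ n ≡ count (λ k → coprime? k n) n
  φ≡count n = filter≡count (λ k → coprime? k n) n

  count-ext : {P Q : ℕ → Set} (P? : Decidable P) (Q? : Decidable Q) →
    (∀ k → P k → Q k) → (∀ k → Q k → P k) → ∀ N → count P? N ≡ count Q? N
  count-ext P? Q? P⇒Q Q⇒P zero = refl
  count-ext P? Q? P⇒Q Q⇒P (suc N) with P? (suc N) | Q? (suc N)
  ... | yes _ | yes _ = cong suc (count-ext P? Q? P⇒Q Q⇒P N)
  ... | yes p | no ¬q = ⊥-elim (¬q (P⇒Q _ p))
  ... | no ¬p | yes q = ⊥-elim (¬p (Q⇒P _ q))
  ... | no _  | no _  = count-ext P? Q? P⇒Q Q⇒P N

  count-split : {P Q : ℕ → Set} (P? : Decidable P) (Q? : Decidable Q) → ∀ N →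
    count P? N ≡ count (λ k → P? k ×-dec Q? k) N + count (λ k → P? k ×-dec ¬? (Q? k)) N
  count-split P? Q? zero = refl
  count-split P? Q? (suc N) with P? (suc N) | Q? (suc N)
  ... | yes _ | yes _ = cong suc (count-split P? Q? N)
  ... | yes _ | no _  = trans (cong suc (count-split P? Q? N)) (sym (ℕP.+-suc _ _))
  ... | no _  | yes _ = count-split P? Q? N
  ... | no _  | no _  = count-split P? Q? N

  count-compl : {P : ℕ → Set} (P? : Decidable P) → ∀ N → count P? N + count (λ k → ¬? (P? k)) N ≡ N
  count-compl P? zero = refl
  count-compl P? (suc N) with P? (suc N)
  ... | yes _ = cong suc (count-compl P? N)
  ... | no _  = trans (ℕP.+-suc _ _) (cong suc (count-compl P? N))

  count-yes : {P : ℕ → Set} (P? : Decidable P) (N : ℕ) → P (suc N) → count P? (suc N) ≡ suc (count P? N)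
  count-yes P? N p with P? (suc N)
  ... | yes _ = refl
  ... | no ¬p = ⊥-elim (¬p p)

  count-no : {P : ℕ → Set} (P? : Decidable P) (N : ℕ) → ¬ P (suc N) → count P? (suc N) ≡ count P? N
  count-no P? N ¬p with P? (suc N)
  ... | yes p = ⊥-elim (¬p p)
  ... | no _ = refl

  module _ (d : ℕ) where
    private
      q = suc d

    count-multiples-block : ∀ M r → r ≤ d → count (q ∣?_) (q * M + r) ≡ M
    count-multiples-block zero zero _ = cong (count (q ∣?_)) (trans (ℕP.+-identityʳ (q * 0)) (ℕP.*-zeroʳ q))
    count-multiples-block (suc M) zero _ = begin
      count (q ∣?_) (q * suc M + 0)    ≡⟨ cong (count (q ∣?_)) (trans (ℕP.+-identityʳ _) qM′≡) ⟩
      count (q ∣?_) (suc (q * M + d))  ≡⟨ count-yes (q ∣?_) (q * M + d) (subst (q ∣_) qM′≡ (ℕ∣.m∣m*n (suc M))) ⟩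
      suc (count (q ∣?_) (q * M + d))  ≡⟨ cong suc (count-multiples-block M d ℕP.≤-refl) ⟩
      suc M                            ∎
      where
      open ≡-Reasoning
      qM′≡ : q * suc M ≡ suc (q * M + d)
      qM′≡ = trans (ℕP.*-suc q M) (trans (ℕP.+-comm q (q * M)) (ℕP.+-suc (q * M) d))
    count-multiples-block M (suc r) r<d = begin
      count (q ∣?_) (q * M + suc r)    ≡⟨ cong (count (q ∣?_)) (ℕP.+-suc (q * M) r) ⟩
      count (q ∣?_) (suc (q * M + r))  ≡⟨ count-no (q ∣?_) (q * M + r) q∤ ⟩
      count (q ∣?_) (q * M + r)        ≡⟨ count-multiples-block M r (ℕP.<⇒≤ r<d) ⟩
      M                                ∎
      where
      open ≡-Reasoning
      -- q divides q·M, so it cannot divide q·M + (r + 1) with 0 < r + 1 < q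
      q∤ : ¬ (q ∣ suc (q * M + r))
      q∤ q∣ = ℕP.<⇒≱ (s≤s r<d) (ℕ∣.∣⇒≤ (ℕ∣.∣m+n∣m⇒∣n (subst (q ∣_) (sym (ℕP.+-suc (q * M) r)) q∣) (ℕ∣.m∣m*n M)))

    count-multiples : ∀ M → count (q ∣?_) (q * M) ≡ M
    count-multiples M = trans (cong (count (q ∣?_)) (sym (ℕP.+-identityʳ (q * M)))) (count-multiples-block M 0 z≤n)

  count-multiples′ : ∀ q → 1 ≤ q → ∀ M → count (q ∣?_) (q * M) ≡ M
  count-multiples′ (suc d) _ = count-multiples d

  coprime-prime-power⇒∤ : ∀ {p} α → Prime p → ∀ k → Coprime k (p ^ suc α) → ¬ (p ∣ k)
  coprime-prime-power⇒∤ {p} α pp k c p∣k = ℕP.<-irrefl (sym (c (p∣k , ℕ∣.m∣m*n (p ^ α)))) (prime>1 pp)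

  ∤⇒coprime-prime-power : ∀ {p} α → Prime p → ∀ k → ¬ (p ∣ k) → Coprime k (p ^ suc α)
  ∤⇒coprime-prime-power α pp k p∤k = Coprimality.sym (coprime-^ˡ (suc α) (prime-coprime pp p∤k))

  -- φ(p^(α+1)) = p^α (p - 1): remove the p^α multiples of p from 1, …, p^(α+1).
  φ-prime-power : ∀ {p} → Prime p → ∀ α → φ (p ^ suc α) ≡ p ^ α * (p ∸ 1)
  φ-prime-power {p} pp α = ℕP.+-cancelˡ-≡ (p ^ α) _ _ (begin
    p ^ α + φ P                                 ≡⟨ cong₂ _+_ (sym (count-multiples′ p p≥1 (p ^ α))) φP≡ ⟩
    count (p ∣?_) P + count (λ k → ¬? (p ∣? k)) P ≡⟨ count-compl (p ∣?_) P ⟩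
    P                                           ≡⟨ cong (λ r → r * p ^ α) (prime≡suc pp) ⟩
    suc (p ∸ 1) * p ^ α                         ≡⟨ cong (p ^ α +_) (ℕP.*-comm (p ∸ 1) (p ^ α)) ⟩
    p ^ α + p ^ α * (p ∸ 1)                     ∎)
    where
    open ≡-Reasoning
    P = p ^ suc α
    p≥1 : 1 ≤ p
    p≥1 = ℕP.<⇒≤ (prime>1 pp)
    φP≡ : φ P ≡ count (λ k → ¬? (p ∣? k)) P
    φP≡ = trans (φ≡count P) (count-ext _ _ (coprime-prime-power⇒∤ α pp) (∤⇒coprime-prime-power α pp) P)

  -- φ is multiplicative on powers of two distinct primes, by inclusion–exclusion on
  -- the multiples of p and of q among 1, …, p^(α+1) q^(β+1).
  module _ {p q : ℕ} (pp : Prime p) (pq : Prime q) (p≢q : p ≢ q) (α β : ℕ) where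
    private
      P′ = p ^ α
      Q′ = q ^ β
      P = p ^ suc α
      Q = q ^ suc β
      N = P * Q
      p∣? = p ∣?_
      q∣? = q ∣?_
      #p = count p∣? N
      #q = count q∣? N
      #pq = count (λ k → q∣? k ×-dec p∣? k) N
      #¬p = count (λ k → ¬? (p∣? k)) N
      #¬p,q = count (λ k → ¬? (p∣? k) ×-dec q∣? k) N
      #¬p,¬q = count (λ k → ¬? (p∣? k) ×-dec ¬? (q∣? k)) N

      φN≡#¬p,¬q : φ N ≡ #¬p,¬q
      φN≡#¬p,¬q = trans (φ≡count N) (count-ext _ _ units⇒ ⇒units N)
        where
        units⇒ : ∀ k → Coprime k N → ¬ (p ∣ k) × ¬ (q ∣ k)
        units⇒ k c = coprime-prime-power⇒∤ α pp k (λ (d∣k , d∣P) → c (d∣k , ℕ∣.∣-trans d∣P (ℕ∣.m∣m*n Q)))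
                   , coprime-prime-power⇒∤ β pq k (λ (d∣k , d∣Q) → c (d∣k , ℕ∣.∣-trans d∣Q (ℕ∣.n∣m*n P)))
        ⇒units : ∀ k → ¬ (p ∣ k) × ¬ (q ∣ k) → Coprime k N
        ⇒units k (p∤k , q∤k) = Coprimality.sym (coprime-*ˡ (Coprimality.sym (∤⇒coprime-prime-power α pp k p∤k))
                                                            (Coprimality.sym (∤⇒coprime-prime-power β pq k q∤k)))

      #p≡ : #p ≡ P′ * Q
      #p≡ = trans (cong (count p∣?) (ℕP.*-assoc p P′ Q)) (count-multiples′ p (ℕP.<⇒≤ (prime>1 pp)) (P′ * Q))

      #q≡ : #q ≡ P * Q′
      #q≡ = trans (cong (count q∣?) N≡) (count-multiples′ q (ℕP.<⇒≤ (prime>1 pq)) (P * Q′))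
        where N≡ : N ≡ q * (P * Q′)
              N≡ = trans (ℕP.*-comm P Q) (trans (ℕP.*-assoc q Q′ P) (cong (q *_) (ℕP.*-comm Q′ P)))

      -- being divisible by p and by q means being divisible by pq
      #pq≡ : #pq ≡ P′ * Q′
      #pq≡ = trans (count-ext _ _ both⇒pq pq⇒both N) (trans (cong (count ((p * q) ∣?_)) N≡)
                   (count-multiples′ (p * q) (ℕP.*-mono-≤ (ℕP.<⇒≤ (prime>1 pp)) (ℕP.<⇒≤ (prime>1 pq))) (P′ * Q′)))
        where
        p⊥q : Coprime p q
        p⊥q = distinct-primes-coprime pp pq p≢q
        both⇒pq : ∀ k → q ∣ k × p ∣ k → p * q ∣ k
        both⇒pq k (q∣k , p∣k) = coprime-∣-* p⊥q p∣k q∣k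
        pq⇒both : ∀ k → p * q ∣ k → q ∣ k × p ∣ k
        pq⇒both k pq∣k = ℕ∣.∣-trans (ℕ∣.n∣m*n p) pq∣k , ℕ∣.∣-trans (ℕ∣.m∣m*n q) pq∣k
        N≡ : N ≡ (p * q) * (P′ * Q′)
        N≡ = interchange p q P′ Q′
          where interchange : ∀ p q a b → p * a * (q * b) ≡ (p * q) * (a * b)
                interchange = ℕSolver.solve-∀

      inclusion-exclusion : #p + #q + #¬p,¬q ≡ #pq + N
      inclusion-exclusion = begin
        #p + #q + #¬p,¬q                 ≡⟨ cong (λ t → #p + t + #¬p,¬q) #q≡#pq+#¬p,q ⟩
        #p + (#pq + #¬p,q) + #¬p,¬q      ≡⟨ rearrange #p #pq #¬p,q #¬p,¬q ⟩
        #pq + (#p + (#¬p,q + #¬p,¬q))    ≡⟨ cong (λ t → #pq + (#p + t)) (sym (count-split (λ k → ¬? (p∣? k)) q∣? N)) ⟩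
        #pq + (#p + #¬p)                 ≡⟨ cong (#pq +_) (count-compl p∣? N) ⟩
        #pq + N                          ∎
        where
        open ≡-Reasoning
        rearrange : ∀ a b c d → a + (b + c) + d ≡ b + (a + (c + d))
        rearrange = ℕSolver.solve-∀
        #q≡#pq+#¬p,q : #q ≡ #pq + #¬p,q
        #q≡#pq+#¬p,q = trans (count-split q∣? p∣? N)
          (cong (#pq +_) (count-ext _ _ (λ _ (a , b) → b , a) (λ _ (a , b) → b , a) N))

    φ-two-prime-powers : φ (p ^ suc α * q ^ suc β) ≡ φ (p ^ suc α) * φ (q ^ suc β)
    φ-two-prime-powers = begin
      φ N                                        ≡⟨ φN≡#¬p,¬q ⟩
      #¬p,¬q                                     ≡⟨ ℕP.+-cancelˡ-≡ (#p + #q) _ _ (trans inclusion-exclusion (sym solved)) ⟩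
      P′ * (p ∸ 1) * (Q′ * (q ∸ 1))              ≡⟨ sym (cong₂ _*_ (φ-prime-power pp α) (φ-prime-power pq β)) ⟩
      φ P * φ Q                                  ∎
      where
      open ≡-Reasoning
      identity : ∀ P′ Q′ p₁ q₁ → P′ * (suc q₁ * Q′) + (suc p₁ * P′) * Q′ + P′ * p₁ * (Q′ * q₁)
                                ≡ P′ * Q′ + (suc p₁ * P′) * (suc q₁ * Q′)
      identity = ℕSolver.solve-∀
      p₁ = p ∸ 1
      q₁ = q ∸ 1
      solved : #p + #q + P′ * p₁ * (Q′ * q₁) ≡ #pq + N
      solved = begin
        #p + #q + P′ * p₁ * (Q′ * q₁)                         ≡⟨ cong₂ (λ a b → a + b + P′ * p₁ * (Q′ * q₁)) #p≡′ #q≡′ ⟩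
        P′ * (suc q₁ * Q′) + suc p₁ * P′ * Q′ + P′ * p₁ * (Q′ * q₁) ≡⟨ identity P′ Q′ p₁ q₁ ⟩
        P′ * Q′ + suc p₁ * P′ * (suc q₁ * Q′)                 ≡⟨ cong₂ _+_ (sym #pq≡) (sym N≡) ⟩
        #pq + N                                              ∎
        where
        #p≡′ : #p ≡ P′ * (suc q₁ * Q′)
        #p≡′ = trans #p≡ (cong (λ r → P′ * (r * Q′)) (prime≡suc pq))
        #q≡′ : #q ≡ suc p₁ * P′ * Q′
        #q≡′ = trans #q≡ (cong (λ r → r * P′ * Q′) (prime≡suc pp))
        N≡ : N ≡ suc p₁ * P′ * (suc q₁ * Q′)
        N≡ = cong₂ (λ r s → r * P′ * (s * Q′)) (prime≡suc pp) (prime≡suc pq)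

module FiniteDifferences where

  open import Data.Nat using (ℕ; zero; suc; _≤_; _<_; z≤n; s≤s)
  import Data.Nat.Properties as ℕP
  open import Data.Integer using (ℤ; +_; _+_; _*_; _-_; -_; _^_)
  import Data.Integer.Properties as ℤP
  open import Data.Integer.Tactic.RingSolver using (solve-∀)
  open import Relation.Binary.PropositionalEquality using (_≡_; refl; sym; trans; cong; cong₂)
  open IntegerDivisibility
  open Congruence

  Δ : (ℕ → ℤ) → ℕ → ℤ
  Δ f i = f (suc i) - f i

  Degree≤ : ℕ → (ℕ → ℤ) → Set
  Degree≤ zero f = ∀ i → f i ≡ f 0
  Degree≤ (suc d) f = Degree≤ d (Δ f)

  -- The alternating binomial sum  ∇ K f = Σᵢ (-1)ⁱ (K choose i) f(i), i.e. ±(Δᴷ f)(0).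
  ∇ : ℕ → (ℕ → ℤ) → ℤ
  ∇ zero f = f 0
  ∇ (suc K) f = ∇ K f - ∇ K (λ i → f (suc i))

  ∇-ext : ∀ K {f g} → (∀ i → f i ≡ g i) → ∇ K f ≡ ∇ K g
  ∇-ext zero f≗g = f≗g 0
  ∇-ext (suc K) f≗g = cong₂ _-_ (∇-ext K f≗g) (∇-ext K (λ i → f≗g (suc i)))

  ∇-sub : ∀ K f g → ∇ K (λ i → f i - g i) ≡ ∇ K f - ∇ K g
  ∇-sub zero f g = refl
  ∇-sub (suc K) f g = trans (cong₂ _-_ (∇-sub K f g) (∇-sub K (λ i → f (suc i)) (λ i → g (suc i))))
                            (interchange (∇ K f) (∇ K g) (∇ K (λ i → f (suc i))) (∇ K (λ i → g (suc i))))
    where interchange : ∀ a b c d → (a - b) - (c - d) ≡ (a - c) - (b - d)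
          interchange = solve-∀

  ∇-Δ : ∀ K f → ∇ (suc K) f ≡ - ∇ K (Δ f)
  ∇-Δ K f = trans (a-b≡-[b-a] (∇ K f) (∇ K (λ i → f (suc i)))) (cong -_ (sym (∇-sub K (λ i → f (suc i)) f)))
    where a-b≡-[b-a] : ∀ a b → a - b ≡ - (b - a)
          a-b≡-[b-a] = solve-∀

  ∇-degree : ∀ d K f → Degree≤ d f → d < K → ∇ K f ≡ + 0
  ∇-degree zero (suc K) f const _ =
    trans (cong (λ t → ∇ K f - t) (∇-ext K (λ i → trans (const (suc i)) (sym (const i))))) (ℤP.+-inverseʳ (∇ K f))
  ∇-degree (suc d) (suc K) f deg (s≤s d<K) = trans (∇-Δ K f) (cong -_ (∇-degree d K (Δ f) deg d<K))

  Degree≤-ext : ∀ d {f g} → (∀ i → f i ≡ g i) → Degree≤ d f → Degree≤ d g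
  Degree≤-ext zero f≗g deg i = trans (sym (f≗g i)) (trans (deg i) (f≗g 0))
  Degree≤-ext (suc d) f≗g deg = Degree≤-ext d (λ i → cong₂ _-_ (f≗g (suc i)) (f≗g i)) deg

  Degree≤-suc : ∀ d f → Degree≤ d f → Degree≤ (suc d) f
  Degree≤-suc zero f const i = trans (cong₂ _-_ (const (suc i)) (const i)) (sym (cong₂ _-_ (const 1) (const 0)))
  Degree≤-suc (suc d) f deg = Degree≤-suc d (Δ f) deg

  Degree≤-const : ∀ d c → Degree≤ d (λ _ → c)
  Degree≤-const zero c i = refl
  Degree≤-const (suc d) c = Degree≤-suc d (λ _ → c) (Degree≤-const d c)

  Degree≤-+ : ∀ d f g → Degree≤ d f → Degree≤ d g → Degree≤ d (λ i → f i + g i)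
  Degree≤-+ zero f g df dg i = cong₂ _+_ (df i) (dg i)
  Degree≤-+ (suc d) f g df dg = Degree≤-ext d (λ i → sym (interchange (f (suc i)) (g (suc i)) (f i) (g i)))
                                            (Degree≤-+ d (Δ f) (Δ g) df dg)
    where interchange : ∀ a b c d → (a + b) - (c + d) ≡ (a - c) + (b - d)
          interchange = solve-∀

  Degree≤-shift : ∀ d f → Degree≤ d f → Degree≤ d (λ i → f (suc i))
  Degree≤-shift zero f const i = trans (const (suc i)) (sym (const 1))
  Degree≤-shift (suc d) f deg = Degree≤-shift d (Δ f) deg

  Δ-index-* : ∀ f i → + (suc i) * f (suc i) - + i * f i ≡ + i * Δ f i + f (suc i)
  Δ-index-* f i = trans (cong (λ k → k * f (suc i) - + i * f i) (trans (ℤP.pos-+ 1 i) (ℤP.+-comm (+ 1) (+ i))))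
                        (identity (+ i) (f (suc i)) (f i))
    where
    identity : ∀ i a b → (i + + 1) * a - i * b ≡ i * (a - b) + a
    identity = solve-∀

  Degree≤-index-* : ∀ d f → Degree≤ d f → Degree≤ (suc d) (λ i → + i * f i)
  Degree≤-index-* zero f const = Degree≤-ext 0 (λ i → sym (trans (Δ-index-* f i) (Δf≡0 i))) (Degree≤-shift 0 f const)
    where
    Δf≡0 : ∀ i → + i * Δ f i + f (suc i) ≡ f (suc i)
    Δf≡0 i = trans (cong (λ t → + i * t + f (suc i)) (trans (cong₂ _-_ (const (suc i)) (const i)) (ℤP.+-inverseʳ (f 0))))
                   (trans (cong (_+ f (suc i)) (ℤP.*-zeroʳ (+ i))) (ℤP.+-identityˡ (f (suc i))))
  Degree≤-index-* (suc d) f deg = Degree≤-ext (suc d) (λ i → sym (Δ-index-* f i))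
    (Degree≤-+ (suc d) (λ i → + i * Δ f i) (λ i → f (suc i)) (Degree≤-index-* d (Δ f) deg) (Degree≤-shift (suc d) f deg))

  Degree≤-power : ∀ E → Degree≤ E (λ i → (+ i) ^ E)
  Degree≤-power zero i = refl
  Degree≤-power (suc E) = Degree≤-index-* E (λ i → (+ i) ^ E) (Degree≤-power E)

  -- ∇ K only sees the values at 0, …, K, so it respects congruences there.
  ∇-≋ : ∀ {N} K f g → (∀ i → i ≤ K → f i ≋ g i [ N ]) → ∇ K f ≋ ∇ K g [ N ]
  ∇-≋ zero f g f≋g = f≋g 0 z≤n
  ∇-≋ (suc K) f g f≋g = ≋-+ (∇-≋ K f g (λ i i≤K → f≋g i (ℕP.m≤n⇒m≤1+n i≤K)))
                            (≋-neg (∇-≋ K (λ i → f (suc i)) (λ i → g (suc i)) (λ i i≤K → f≋g (suc i) (s≤s i≤K))))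

  δ : ℕ → ℤ
  δ zero = - + 1
  δ (suc i) = + 0

  ∇-δ : ∀ K → ∇ K δ ≡ - + 1
  ∇-δ zero = refl
  ∇-δ (suc K) = cong₂ _-_ (∇-δ K) (∇-zero K)
    where
    ∇-zero : ∀ K → ∇ K (λ _ → + 0) ≡ + 0
    ∇-zero zero = refl
    ∇-zero (suc K) = cong₂ _-_ (∇-zero K) (∇-zero K)

  -- The key consequence: x ↦ x^E cannot be ≡ 1 at all of 1, …, E+1 unless N ∣ 1.
  -- (Applying ∇ (E+1) to xᴱ − 1, which has degree E, gives 0; but modulo N the sequence
  -- is −1, 0, …, 0, whose ∇ (E+1) is −1.)
  powers≋1⇒0≋-1 : ∀ N E → 1 ≤ E → (∀ x → 1 ≤ x → x ≤ suc E → (+ x) ^ E ≋ + 1 [ N ]) → + 0 ≋ - + 1 [ N ]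
  powers≋1⇒0≋-1 N E E≥1 xᴱ≋1 =
    ≋-trans (≋-reflexive (sym ∇f≡0)) (≋-trans (∇-≋ (suc E) f δ f≋δ) (≋-reflexive (∇-δ (suc E))))
    where
    f : ℕ → ℤ
    f i = (+ i) ^ E - + 1
    ∇f≡0 : ∇ (suc E) f ≡ + 0
    ∇f≡0 = ∇-degree E (suc E) f (Degree≤-+ E _ _ (Degree≤-power E) (Degree≤-const E (- + 1))) ℕP.≤-refl
    0^E≡0 : ∀ E → 1 ≤ E → (+ 0) ^ E ≡ + 0
    0^E≡0 (suc E) _ = refl
    f≋δ : ∀ i → i ≤ suc E → f i ≋ δ i [ N ]
    f≋δ zero _ = ≋-reflexive (cong (_- + 1) (0^E≡0 E E≥1))
    f≋δ (suc i) i≤ = ≋-trans (≋-+ (xᴱ≋1 (suc i) (s≤s z≤n) i≤) (≋-refl (- + 1))) (≋-reflexive (ℤP.+-inverseʳ (+ 1)))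

module PrimitiveRootModPrime where

  open import Data.Nat as ℕ using (ℕ; zero; suc; _≤_; _<_; _∸_; z≤n; s≤s)
  import Data.Nat.Properties as ℕP
  open import Data.Nat.Divisibility as ℕ∣ using (_∣_)
  open import Data.Nat.Primality using (Prime; prime⇒nonZero)
  open import Data.Integer using (ℤ; +_; _*_; _-_; _^_)
  import Data.Integer.Properties as ℤP
  open import Data.Integer.Tactic.RingSolver using (solve-∀)
  open import Data.Empty using (⊥-elim)
  open import Data.Product using (Σ; ∃-syntax; _×_; _,_; proj₁; proj₂)
  open import Data.Sum using (inj₁; inj₂)
  open import Relation.Nullary using (¬_; yes; no)
  open import Relation.Binary.PropositionalEquality using (_≡_; _≢_; refl; sym; trans; cong; subst)
  open NatFacts
  open IntegerDivisibility
  open Congruence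
  open Orders
  open FiniteDifferences using (powers≋1⇒0≋-1)

  module _ (p : ℕ) (pp : Prime p) where

    instance
      p≢0 : ℕ.NonZero p
      p≢0 = prime⇒nonZero pp

    Unit : ℤ → Set
    Unit x = ¬ (+ p ∣ℤ x)

    unit-* : ∀ {a b} → Unit a → Unit b → Unit (a * b)
    unit-* {a} {b} ua ub p∣ab with euclidℤ pp a b p∣ab
    ... | inj₁ p∣a = ua p∣a
    ... | inj₂ p∣b = ub p∣b

    unit-1 : Unit (+ 1)
    unit-1 p∣1 = ℕP.<-irrefl (sym (ℕ∣.∣1⇒≡1 (∣ℤ⇒∣ (+ 1) p∣1))) (prime>1 pp)

    unit-^ : ∀ {a} k → Unit a → Unit (a ^ k)
    unit-^ zero _ = unit-1
    unit-^ (suc k) u = unit-* u (unit-^ k u)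

    unit-small : ∀ x → 1 ≤ x → x < p → Unit (+ x)
    unit-small x x≥1 x<p p∣x = ℕP.<⇒≱ x<p (ℕ∣.∣⇒≤ {{ℕ.>-nonZero x≥1}} (∣ℤ⇒∣ (+ x) p∣x))

    residue≢0 : ∀ a → Unit a → residue p a ≢ 0
    residue≢0 a u r≡0 = u (subst (_ ∣ℤ_) (ℤP.+-identityʳ a) (N∣a-b (subst (λ r → a ≋ + r [ p ]) r≡0 (≋residue p a))))

    residue≥1 : ∀ a → Unit a → 1 ≤ residue p a
    residue≥1 a u = ℕP.n≢0⇒n>0 (residue≢0 a u)

    cancel-power : ∀ x → Unit x → ∀ i d → x ^ i ≋ x ^ (i ℕ.+ d) [ p ] → x ^ d ≋ + 1 [ p ]
    cancel-power x ux i d xⁱ≋xⁱ⁺ᵈ with euclidℤ pp (x ^ i) (x ^ d - + 1) p∣xⁱ[xᵈ-1]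
      where
      p∣xⁱ[xᵈ-1] : + p ∣ℤ x ^ i * (x ^ d - + 1)
      p∣xⁱ[xᵈ-1] = subst (_ ∣ℤ_) (trans (cong (_- x ^ i) (ℤP.^-distribˡ-+-* x i d)) (factor (x ^ i) (x ^ d)))
                         (N∣a-b (≋-sym xⁱ≋xⁱ⁺ᵈ))
        where factor : ∀ a b → a * b - a ≡ a * (b - + 1)
              factor = solve-∀
    ... | inj₁ p∣xⁱ = ⊥-elim (unit-^ i ux p∣xⁱ)
    ... | inj₂ p∣xᵈ-1 = mk≋ p∣xᵈ-1

    slot : ℤ → ℕ → ℕ
    slot x i = residue p (x ^ i) ∸ 1

    slot<p-1 : ∀ x → Unit x → ∀ i → slot x i < p ∸ 1
    slot<p-1 x ux i = ℕP.∸-monoˡ-< (residue<N p (x ^ i)) (residue≥1 (x ^ i) (unit-^ i ux))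

    -- Every unit has finite order ≤ p - 1: by pigeonhole, two of the p residues of
    -- x⁰, …, x^(p-1), all lying in {1, …, p-1}, coincide.
    finite-order : ∀ x → Unit x → ∃[ k ] (1 ≤ k × k ≤ p ∸ 1 × x ^ k ≋ + 1 [ p ])
    finite-order x ux with pigeonhole-ℕ (p ∸ 1) (slot x) (slot<p-1 x ux)
    ... | i , j , i<j , j≤p-1 , slots≡ =
      j ∸ i , ℕP.m<n⇒0<n∸m i<j , ℕP.≤-trans (ℕP.m∸n≤m j i) j≤p-1 , cancel-power x ux i (j ∸ i) xⁱ≋xʲ
      where
      residues≡ : residue p (x ^ i) ≡ residue p (x ^ j)
      residues≡ = ℕP.∸-cancelʳ-≡ (residue≥1 (x ^ i) (unit-^ i ux)) (residue≥1 (x ^ j) (unit-^ j ux)) slots≡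
      xⁱ≋xʲ : x ^ i ≋ x ^ (i ℕ.+ (j ∸ i)) [ p ]
      xⁱ≋xʲ = ≋-trans (residue-≡⇒≋ p _ _ residues≡) (≋-reflexive (cong (x ^_) (sym (ℕP.m+[n∸m]≡n (ℕP.<⇒≤ i<j)))))

    order-of : ∀ x → Unit x → Σ ℕ λ d → Order p x d × d ≤ p ∸ 1
    order-of x ux = bounded (finite-order x ux)
      where
      bounded : ∃[ k ] (1 ≤ k × k ≤ p ∸ 1 × x ^ k ≋ + 1 [ p ]) → Σ ℕ λ d → Order p x d × d ≤ p ∸ 1
      bounded (k , k≥1 , k≤p-1 , xᵏ≋1) =
        let d , o , d≤k = Order-exists x k k≥1 xᵏ≋1 in d , o , ℕP.≤-trans d≤k k≤p-1

    record MaxOrder (K : ℕ) : Set where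
      constructor max-order
      field
        g       : ℕ
        g≥1     : 1 ≤ g
        g<p     : g < p
        D       : ℕ
        order-g : Order p (+ g) D
        D≤p-1   : D ≤ p ∸ 1
        maximal : ∀ x d → 1 ≤ x → x ≤ K → Order p (+ x) d → d ≤ D

    maximal-order : ∀ K → 1 ≤ K → K < p → MaxOrder K
    maximal-order (suc zero) _ 1<p = start (order-of (+ 1) unit-1)
      where
      start : Σ ℕ (λ d → Order p (+ 1) d × d ≤ p ∸ 1) → MaxOrder 1
      start (d , o , d≤p-1) = max-order 1 ℕP.≤-refl 1<p d o d≤p-1 only-1
        where
        only-1 : ∀ x d′ → 1 ≤ x → x ≤ 1 → Order p (+ x) d′ → d′ ≤ d
        only-1 (suc zero) d′ _ _ o′ = ℕP.≤-reflexive (Order-unique o′ o)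
        only-1 (suc (suc _)) _ _ (s≤s ()) _
    maximal-order (suc (suc K)) _ K+2<p =
      extend (maximal-order (suc K) (s≤s z≤n) (ℕP.<-trans (ℕP.n<1+n _) K+2<p))
             (order-of (+ x) (unit-small x (s≤s z≤n) K+2<p))
      where
      x = suc (suc K)
      extend : MaxOrder (suc K) → Σ ℕ (λ d → Order p (+ x) d × d ≤ p ∸ 1) → MaxOrder x
      extend (max-order g g≥1 g<p D oD D≤ maximal) (d′ , o′ , d′≤) with d′ ℕP.≤? D
      ... | yes d′≤D = max-order g g≥1 g<p D oD D≤ maximal′
        where
        maximal′ : ∀ y d → 1 ≤ y → y ≤ x → Order p (+ y) d → d ≤ D
        maximal′ y d y≥1 y≤x o with ℕP.m≤n⇒m<n∨m≡n y≤x
        ... | inj₁ y<x = maximal y d y≥1 (ℕP.≤-pred y<x) o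
        ... | inj₂ refl = ℕP.≤-trans (ℕP.≤-reflexive (Order-unique o o′)) d′≤D
      ... | no d′≰D = max-order x (s≤s z≤n) K+2<p d′ o′ d′≤ maximal′
        where
        maximal′ : ∀ y d → 1 ≤ y → y ≤ x → Order p (+ y) d → d ≤ d′
        maximal′ y d y≥1 y≤x o with ℕP.m≤n⇒m<n∨m≡n y≤x
        ... | inj₁ y<x = ℕP.≤-trans (maximal y d y≥1 (ℕP.≤-pred y<x) o) (ℕP.<⇒≤ (ℕP.≰⇒> d′≰D))
        ... | inj₂ refl = ℕP.≤-reflexive (Order-unique o o′)

    private
      p-1≥1 : 1 ≤ p ∸ 1
      p-1≥1 = ℕP.m<n⇒0<n∸m (prime>1 pp)

      p-1<p : p ∸ 1 < p
      p-1<p = ℕP.∸-monoʳ-< {p} {1} {0} (s≤s z≤n) (ℕP.<⇒≤ (prime>1 pp))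

    -- The maximal order is an exponent of the whole unit group: every unit y has
    -- yᴰ ≡ 1, for otherwise larger-order would produce a residue of order > D.
    module _ (M : MaxOrder (p ∸ 1)) where
      open MaxOrder M

      exponent : ∀ y → Unit y → y ^ D ≋ + 1 [ p ]
      exponent y uy = from-order (order-of y uy)
        where
        from-order : Σ ℕ (λ b → Order p y b × b ≤ p ∸ 1) → y ^ D ≋ + 1 [ p ]
        from-order (b , ob , _) with b ℕ∣.∣? D
        ... | yes b∣D = power≋1-∣ (kills ob) b∣D
        ... | no b∤D = too-large (larger-order order-g ob b∤D)
          where
          too-large : ∃[ s ] ∃[ t ] ∃[ D⁺ ] (Order p ((+ g) ^ s * y ^ t) D⁺ × D < D⁺) → y ^ D ≋ + 1 [ p ]
          too-large (s , t , D⁺ , oz , D<D⁺) = ⊥-elim (ℕP.<⇒≱ D<D⁺ (maximal r D⁺ (residue≥1 z uz) r≤p-1 (Order-resp (≋residue p z) oz)))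
            where
            z : ℤ
            z = (+ g) ^ s * y ^ t
            uz : Unit z
            uz = unit-* (unit-^ s (unit-small g g≥1 g<p)) (unit-^ t uy)
            r : ℕ
            r = residue p z
            r≤p-1 : r ≤ p ∸ 1
            r≤p-1 = ℕP.≤-pred (subst (r <_) (prime≡suc pp) (residue<N p z))

      -- by the finite difference argument, an exponent of all of 1, …, p-1 is ≥ p-1
      D≡p-1 : D ≡ p ∸ 1
      D≡p-1 with D ℕP.<? p ∸ 1
      ... | no D≮p-1 = ℕP.≤-antisym D≤p-1 (ℕP.≮⇒≥ D≮p-1)
      ... | yes D<p-1 = ⊥-elim (ℕP.<-irrefl (sym (ℕ∣.∣1⇒≡1 (∣ℤ⇒∣ (+ 1) p∣1))) (prime>1 pp))
        where
        p∣1 : + p ∣ℤ + 1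
        p∣1 = N∣a-b (powers≋1⇒0≋-1 p D (positive order-g)
                        (λ x x≥1 x≤D+1 → exponent (+ x) (unit-small x x≥1 (ℕP.≤-<-trans (ℕP.≤-trans x≤D+1 D<p-1) p-1<p))))

    primitive-root : ∃[ g ] (1 ≤ g × g < p × Order p (+ g) (p ∸ 1))
    primitive-root = g , g≥1 , g<p , subst (Order p (+ g)) (D≡p-1 M) order-g
      where
      M : MaxOrder (p ∸ 1)
      M = maximal-order (p ∸ 1) p-1≥1 p-1<p
      open MaxOrder M

module LiftingToPrimePowers where

  open import Data.Nat as ℕ using (ℕ; zero; suc; _≤_; _<_; _∸_; z≤n; s≤s)
  import Data.Nat.Properties as ℕP
  open import Data.Nat.Divisibility as ℕ∣ using (_∣_; divides)
  import Data.Nat.Tactic.RingSolver as ℕSolver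
  open import Data.Nat.Primality using (Prime; prime⇒nonZero)
  open import Data.Integer as ℤ using (ℤ; +_; _+_; _*_; _-_; -_; _^_)
  import Data.Integer.Properties as ℤP
  import Data.Integer.Divisibility.Signed as ℤ∣
  open import Data.Integer.Tactic.RingSolver using (solve-∀)
  open import Data.Product using (∃-syntax; _×_; _,_; proj₁; proj₂)
  open import Data.Sum using (inj₁; inj₂)
  open import Relation.Nullary using (¬_; yes; no)
  open import Relation.Binary.PropositionalEquality using (_≡_; _≢_; refl; sym; trans; cong; cong₂; subst; subst₂; module ≡-Reasoning)
  open NatFacts
  open IntegerDivisibility
  open Congruence
  open Orders
  open PrimitiveRootModPrime using (primitive-root)

  T : ℕ → ℕ
  T zero = 0
  T (suc k) = T k ℕ.+ k

  -- For odd k = 2h+1, T k = h·k; in particular an odd prime divides T p.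
  T-odd : ∀ h → T (suc (h ℕ.* 2)) ≡ h ℕ.* suc (h ℕ.* 2)
  T-odd zero = refl
  T-odd (suc h) = trans (cong (λ t → t ℕ.+ suc (h ℕ.* 2) ℕ.+ suc (suc (h ℕ.* 2))) (T-odd h)) (identity h)
    where identity : ∀ h → h ℕ.* suc (h ℕ.* 2) ℕ.+ suc (h ℕ.* 2) ℕ.+ suc (suc (h ℕ.* 2))
                           ≡ suc h ℕ.* suc (suc (suc (h ℕ.* 2)))
          identity = ℕSolver.solve-∀

  binomial : ∀ X k → ∃[ c ] ((+ 1 + X) ^ k ≡ + 1 + + k * X + + T k * X * X + X * X * X * c)
  binomial X zero = + 0 , identity X
    where identity : ∀ X → + 1 ≡ + 1 + + 0 * X + + 0 * X * X + X * X * X * + 0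
          identity = solve-∀
  binomial X (suc k) with binomial X k
  ... | c , expansion = + T k + c + X * c , (begin
    (+ 1 + X) * (+ 1 + X) ^ k
      ≡⟨ cong ((+ 1 + X) *_) expansion ⟩
    (+ 1 + X) * (+ 1 + + k * X + + T k * X * X + X * X * X * c)
      ≡⟨ step X c (+ k) (+ T k) ⟩
    + 1 + (+ k + + 1) * X + (+ T k + + k) * X * X + X * X * X * (+ T k + c + X * c)
      ≡⟨ cong₂ (λ a b → + 1 + a * X + b * X * X + X * X * X * (+ T k + c + X * c))
               (trans (sym (ℤP.pos-+ k 1)) (cong +_ (ℕP.+-comm k 1))) (sym (ℤP.pos-+ (T k) k)) ⟩
    + 1 + + suc k * X + + T (suc k) * X * X + X * X * X * (+ T k + c + X * c) ∎)
    where
    open ≡-Reasoning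
    step : ∀ X c K TK → (+ 1 + X) * (+ 1 + K * X + TK * X * X + X * X * X * c)
         ≡ + 1 + (K + + 1) * X + (TK + K) * X * X + X * X * X * (TK + c + X * c)
    step = solve-∀

  binomial₁ : ∀ X k → ∃[ c ] ((+ 1 + X) ^ k ≡ + 1 + + k * X + X * X * c)
  binomial₁ X k with binomial X k
  ... | c , expansion = + T k + X * c , trans expansion (regroup (+ k) (+ T k) X c)
    where regroup : ∀ K TK X c → + 1 + K * X + TK * X * X + X * X * X * c ≡ + 1 + K * X + X * X * (TK + X * c)
          regroup = solve-∀

  pos-^ : ∀ p k → + (p ℕ.^ k) ≡ (+ p) ^ k
  pos-^ p zero = refl
  pos-^ p (suc k) = trans (ℤP.pos-* p (p ℕ.^ k)) (cong (+ p *_) (pos-^ p k))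

  module _ (p : ℕ) (pp : Prime p) (p≢2 : p ≢ 2) where
    private
      π : ℤ
      π = + p

      instance
        p≢0 : ℕ.NonZero p
        p≢0 = prime⇒nonZero pp

      h : ℕ
      h = p ℕ./ 2

      T-p : + T p ≡ + h * π
      T-p = trans (cong (λ k → + T k) p≡) (trans (cong +_ (trans (T-odd h) (cong (h ℕ.*_) (sym p≡)))) (ℤP.pos-* h p))
        where p≡ = odd-prime pp p≢2

    Exactly1 : ℕ → ℤ → Set
    Exactly1 s a = ∃[ t ] (a ≡ + 1 + π ^ suc s * t × ¬ (π ∣ℤ t))

    -- Raising to the p-th power moves the exact level up by one (needs p odd when s = 0).
    Exactly1-^p : ∀ {s a} → Exactly1 s a → Exactly1 (suc s) (a ^ p)
    Exactly1-^p {s} {a} (t , a≡ , p∤t) with binomial (π ^ suc s * t) p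
    ... | c , expansion = t + π * W , a^p≡ , p∤t′
      where
      P₁ = π ^ s
      W = + h * P₁ * t * t + P₁ * P₁ * t * t * t * c
      a^p≡ : a ^ p ≡ + 1 + π ^ suc (suc s) * (t + π * W)
      X = π * P₁ * t
      a^p≡ = trans (cong (_^ p) a≡) (trans expansion (trans (cong (λ T → + 1 + π * X + T * X * X + X * X * X * c) T-p)
               (regroup π P₁ t (+ h) c)))
        where regroup : ∀ π P₁ t h c → + 1 + π * (π * P₁ * t) + (h * π) * (π * P₁ * t) * (π * P₁ * t) + (π * P₁ * t) * (π * P₁ * t) * (π * P₁ * t) * c
                                      ≡ + 1 + π * (π * P₁) * (t + π * (h * P₁ * t * t + P₁ * P₁ * t * t * t * c))
              regroup = solve-∀
      p∤t′ : ¬ (π ∣ℤ t + π * W)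
      p∤t′ p∣t′ = p∤t (ℤ∣.∣m+n∣n⇒∣m p∣t′ (ℤ∣.∣m⇒∣m*n W (ℤ∣.∣-refl {π})))

    Exactly1-^ : ∀ {s a} r → Exactly1 s a → ¬ (π ∣ℤ + r) → Exactly1 s (a ^ r)
    Exactly1-^ {s} {a} r (t , a≡ , p∤t) p∤r with binomial₁ (π ^ suc s * t) r
    ... | c , expansion = + r * t + π * W , a^r≡ , p∤v
      where
      P₁ = π ^ s
      W = P₁ * t * t * c
      a^r≡ : a ^ r ≡ + 1 + π ^ suc s * (+ r * t + π * W)
      a^r≡ = trans (cong (_^ r) a≡) (trans expansion (regroup π P₁ t (+ r) c))
        where regroup : ∀ π P₁ t r c → + 1 + r * (π * P₁ * t) + (π * P₁ * t) * (π * P₁ * t) * c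
                                      ≡ + 1 + π * P₁ * (r * t + π * (P₁ * t * t * c))
              regroup = solve-∀
      p∤v : ¬ (π ∣ℤ + r * t + π * W)
      p∤v p∣v with euclidℤ pp (+ r) t (ℤ∣.∣m+n∣n⇒∣m p∣v (ℤ∣.∣m⇒∣m*n W (ℤ∣.∣-refl {π})))
      ... | inj₁ p∣r = p∤r p∣r
      ... | inj₂ p∣t = p∤t p∣t

    Exactly1-^p^ : ∀ {a} → Exactly1 0 a → ∀ s → Exactly1 s (a ^ (p ℕ.^ s))
    Exactly1-^p^ {a} e zero = subst (Exactly1 0) (sym (ℤP.^-identityʳ a)) e
    Exactly1-^p^ {a} e (suc s) = subst (Exactly1 (suc s)) a^p^s^p≡ (Exactly1-^p {s} {a ^ (p ℕ.^ s)} (Exactly1-^p^ e s))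
      where a^p^s^p≡ : (a ^ (p ℕ.^ s)) ^ p ≡ a ^ (p ℕ.^ suc s)
            a^p^s^p≡ = trans (ℤP.^-*-assoc a (p ℕ.^ s) p) (cong (a ^_) (ℕP.*-comm (p ℕ.^ s) p))

    Exactly1⇒≋1 : ∀ {s a} → Exactly1 s a → a ≋ + 1 [ p ℕ.^ suc s ]
    Exactly1⇒≋1 {s} {a} (t , a≡ , _) =
      ≋-by (t * π ^ suc s) (trans (cong (_- + 1) a≡) (cancel (π ^ suc s) t))
           (subst (λ P → P ∣ℤ t * π ^ suc s) (sym (pos-^ p (suc s))) (ℤ∣.∣n⇒∣m*n t ℤ∣.∣-refl))
      where cancel : ∀ P t → + 1 + P * t - + 1 ≡ t * P
            cancel = solve-∀

    Exactly1⇒≉1 : ∀ {s a} → Exactly1 s a → ¬ (a ≋ + 1 [ p ℕ.^ suc (suc s) ])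
    Exactly1⇒≉1 {s} {a} (t , a≡ , p∤t) a≋1 = p∤t (ℤ∣.*-cancelˡ-∣ (π ^ suc s) {{π^≢0}} pᵏπ∣pᵏt)
      where
      π^≢0 : ℤ.NonZero (π ^ suc s)
      π^≢0 = subst ℤ.NonZero (pos-^ p (suc s)) (ℕ.>-nonZero (ℕP.m^n>0 p (suc s)))
      -- a - 1 = π^(s+1) t is divisible by π^(s+2) = π^(s+1) π
      pᵏπ∣pᵏt : π ^ suc s * π ∣ℤ π ^ suc s * t
      pᵏπ∣pᵏt = subst₂ _∣ℤ_ (trans (pos-^ p (suc (suc s))) (ℤP.*-comm π (π ^ suc s)))
                             (trans (cong (_- + 1) a≡) (cancel (π ^ suc s) t)) (N∣a-b a≋1)
        where cancel : ∀ P t → + 1 + P * t - + 1 ≡ P * t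
              cancel = solve-∀

    private
      p-1≥1 : 1 ≤ p ∸ 1
      p-1≥1 = ℕP.m<n⇒0<n∸m (prime>1 pp)

      ≋1⇒form : ∀ {a} → a ≋ + 1 [ p ] → ∃[ q ] (a ≡ + 1 + π * q)
      ≋1⇒form {a} (mk≋ (ℤ∣.divides q a-1≡qπ)) = q , trans (a≡1+[a-1] a) (cong (λ d → + 1 + d) (trans a-1≡qπ (ℤP.*-comm q π)))
        where a≡1+[a-1] : ∀ a → a ≡ + 1 + (a - + 1)
              a≡1+[a-1] = solve-∀

      Exactly1-0 : ∀ {a q} → a ≡ + 1 + π * q → ¬ (π ∣ℤ q) → Exactly1 0 (a)
      Exactly1-0 {q = q} a≡ p∤q = q , trans a≡ (cong (λ P → + 1 + P * q) (sym (ℤP.*-identityʳ π))) , p∤q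

    -- Starting from any
    -- primitive root g with g^(p-1) = 1 + pq: if p ∣ q, then h = g(1+p) has
    -- h^(p-1) = 1 + p(q + (p-1) + p·…), and p ∤ q + (p-1).
    good-root : ∃[ h ] (Order p h (p ∸ 1) × Exactly1 0 (h ^ (p ∸ 1)))
    good-root = choose (primitive-root p pp)
      where
      choose : ∃[ g ] (1 ≤ g × g < p × Order p (+ g) (p ∸ 1)) → ∃[ h ] (Order p h (p ∸ 1) × Exactly1 0 (h ^ (p ∸ 1)))
      choose (g , _ , _ , og) = with-form (≋1⇒form (kills og))
        where
        with-form : ∃[ q ] ((+ g) ^ (p ∸ 1) ≡ + 1 + π * q) → ∃[ h ] (Order p h (p ∸ 1) × Exactly1 0 (h ^ (p ∸ 1)))
        with-form (q , gᵖ⁻¹≡) with p ∣ℤ? q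
        ... | no p∤q = + g , og , Exactly1-0 gᵖ⁻¹≡ p∤q
        ... | yes p∣q = + g * (+ 1 + π) , Order-resp g≋h og , Exactly1-0 hᵖ⁻¹≡ p∤t
          where
          g≋h : + g ≋ + g * (+ 1 + π) [ p ]
          g≋h = ≋-by (- (+ g) * π) (g-g[1+π] (+ g) π) (ℤ∣.∣n⇒∣m*n (- (+ g)) ℤ∣.∣-refl)
            where g-g[1+π] : ∀ g π → g - g * (+ 1 + π) ≡ - g * π
                  g-g[1+π] = solve-∀
          K = + (p ∸ 1)
          c = proj₁ (binomial₁ π (p ∸ 1))
          W = c + q * K + π * q * c
          hᵖ⁻¹≡ : (+ g * (+ 1 + π)) ^ (p ∸ 1) ≡ + 1 + π * (q + K + π * W)
          hᵖ⁻¹≡ = trans (^-distribʳ-* (+ g) (+ 1 + π) (p ∸ 1))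
                    (trans (cong₂ _*_ gᵖ⁻¹≡ (proj₂ (binomial₁ π (p ∸ 1)))) (expand π q K c))
            where expand : ∀ π q K c → (+ 1 + π * q) * (+ 1 + K * π + π * π * c)
                                      ≡ + 1 + π * (q + K + π * (c + q * K + π * q * c))
                  expand = solve-∀
          -- p ∣ q, so p ∣ q + K + πW would give p ∣ K = p - 1
          p∤t : ¬ (π ∣ℤ q + K + π * W)
          p∤t p∣t = ℕP.<⇒≱ (ℕP.∸-monoʳ-< {p} {1} {0} (s≤s z≤n) (ℕP.<⇒≤ (prime>1 pp)))
                      (ℕ∣.∣⇒≤ {{ℕ.>-nonZero p-1≥1}} (∣ℤ⇒∣ K p∣K))
            where
            p∣K : π ∣ℤ K
            p∣K = ℤ∣.∣m+n∣m⇒∣n (ℤ∣.∣m+n∣n⇒∣m p∣t (ℤ∣.∣m⇒∣m*n W (ℤ∣.∣-refl {π}))) p∣q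

    order-lift : ∀ {h} → Order p h (p ∸ 1) → Exactly1 0 (h ^ (p ∸ 1)) → ∀ α →
                 Order (p ℕ.^ suc α) h (p ℕ.^ α ℕ.* (p ∸ 1))
    order-lift {h} oh ex α = order (ℕP.*-mono-≤ (ℕP.m^n>0 p α) p-1≥1) h^[pᵅ[p-1]]≋1 minimal′
      where
      P = p ℕ.^ suc α
      G = h ^ (p ∸ 1)
      h^[e[p-1]]≡Gᵉ : ∀ e → h ^ (e ℕ.* (p ∸ 1)) ≡ G ^ e
      h^[e[p-1]]≡Gᵉ e = trans (cong (h ^_) (ℕP.*-comm e (p ∸ 1))) (sym (ℤP.^-*-assoc h (p ∸ 1) e))
      h^[pᵅ[p-1]]≋1 : h ^ (p ℕ.^ α ℕ.* (p ∸ 1)) ≋ + 1 [ P ]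
      h^[pᵅ[p-1]]≋1 = ≋-trans (≋-reflexive (h^[e[p-1]]≡Gᵉ (p ℕ.^ α))) (Exactly1⇒≋1 {α} (Exactly1-^p^ ex α))
      minimal′ : ∀ k → h ^ k ≋ + 1 [ P ] → p ℕ.^ α ℕ.* (p ∸ 1) ∣ k
      minimal′ k hᵏ≋1 with minimal oh k (≋-weaken (ℕ∣.m∣m*n (p ℕ.^ α)) hᵏ≋1)
      ... | divides zero refl = divides 0 refl
      ... | divides e@(suc _) refl = from-valuation (valuation p (prime>1 pp) e (s≤s z≤n))
        where
        -- with e = p^s r and p ∤ r, Gᵉ is ≡ 1 exactly modulo p^(s+1), so α ≤ s
        from-valuation : ∃[ s ] ∃[ r ] (e ≡ p ℕ.^ s ℕ.* r × ¬ (p ∣ r)) → p ℕ.^ α ℕ.* (p ∸ 1) ∣ e ℕ.* (p ∸ 1)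
        from-valuation (s , r , e≡ , p∤r) = ℕ∣.*-monoˡ-∣ (p ∸ 1) (ℕ∣.∣-trans (^-∣-^ p α≤s) (divides r (trans e≡ (ℕP.*-comm _ r))))
          where
          Gᵉ-exact : Exactly1 s (G ^ e)
          Gᵉ-exact = subst (Exactly1 s) (trans (ℤP.^-*-assoc G (p ℕ.^ s) r) (cong (G ^_) (sym e≡)))
                       (Exactly1-^ {s} r (Exactly1-^p^ ex s) (λ p∣r → p∤r (∣ℤ⇒∣ (+ r) p∣r)))
          Gᵉ≋1 : G ^ e ≋ + 1 [ P ]
          Gᵉ≋1 = ≋-trans (≋-reflexive (sym (h^[e[p-1]]≡Gᵉ e))) hᵏ≋1
          α≤s : α ≤ s
          α≤s = ℕP.≮⇒≥ (λ s<α → Exactly1⇒≉1 {s} Gᵉ-exact (≋-weaken (^-∣-^ p (s≤s s<α)) Gᵉ≋1))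

module Generators where

  open import Data.Nat as ℕ using (ℕ; zero; suc; _≤_; _<_)
  import Data.Nat.Properties as ℕP
  open import Data.Nat.Divisibility using (_∣_; divides; ∣-refl)
  open import Data.Nat.Coprimality using (Coprime; coprime?)
  open import Data.Integer using (ℤ; +_; _^_)
  open import Data.List using (List; []; _∷_; map; upTo; filter; length; applyUpTo)
  import Data.List.Properties as List
  open import Data.List.Relation.Unary.Any using (here; there)
  import Data.List.Relation.Unary.Any as Any
  open import Data.List.Relation.Unary.All using (lookup)
  open import Data.List.Relation.Unary.AllPairs using (_∷_)
  import Data.List.Relation.Unary.AllPairs.Properties as AllPairs
  open import Data.List.Relation.Unary.Unique.Propositional using (Unique)
  open import Data.List.Membership.Propositional using (_∈_)
  open import Data.List.Membership.DecPropositional ℕP._≟_ using (_∈?_)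
  import Data.List.Membership.Propositional.Properties as ∈
  open import Data.Empty using (⊥-elim)
  open import Data.Product using (∃-syntax; _×_; _,_)
  open import Relation.Nullary using (yes; no)
  open import Relation.Nullary.Decidable using (¬?)
  open import Relation.Binary.PropositionalEquality using (_≡_; _≢_; refl; sym; subst)
  open import Defs using (φ; CoprimeTo)
  open IntegerDivisibility
  open Congruence
  open Orders

  private
    others : (x : ℕ) → List ℕ → List ℕ
    others x = filter (λ z → ¬? (z ℕP.≟ x))

    others-shorter : ∀ {x} M → x ∈ M → length (others x M) < length M
    others-shorter M x∈M = List.filter-notAll _ M (Any.map (λ { refl ¬¬x≡x → ¬¬x≡x refl }) x∈M)

  unique-⊆⇒≤ : ∀ {L M : List ℕ} → Unique L → (∀ {x} → x ∈ L → x ∈ M) → length L ≤ length M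
  unique-⊆⇒≤ {[]} _ _ = ℕ.z≤n
  unique-⊆⇒≤ {x ∷ L} {M} (x∉L ∷ unique) L⊆M = ℕP.≤-<-trans (unique-⊆⇒≤ unique L⊆others) (others-shorter M (L⊆M (here refl)))
    where
    L⊆others : ∀ {z} → z ∈ L → z ∈ others x M
    L⊆others z∈L = ∈.∈-filter⁺ _ (L⊆M (there z∈L)) (λ { refl → lookup x∉L z∈L refl })

  unique-⊆-≥⇒⊇ : ∀ {L M : List ℕ} → Unique L → (∀ {x} → x ∈ L → x ∈ M) → length M ≤ length L →
                 ∀ {x} → x ∈ M → x ∈ L
  unique-⊆-≥⇒⊇ {L} {M} unique L⊆M M≤L {x} x∈M with x ∈? L
  ... | yes x∈L = x∈L
  ... | no x∉L = ⊥-elim (ℕP.<-irrefl refl (ℕP.≤-<-trans M≤L (ℕP.≤-<-trans (unique-⊆⇒≤ unique L⊆others) (others-shorter M x∈M))))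
    where
    L⊆others : ∀ {z} → z ∈ L → z ∈ others x M
    L⊆others z∈L = ∈.∈-filter⁺ _ (L⊆M z∈L) (λ { refl → x∉L z∈L })

  -- An element x of order φ(P) modulo P generates all units modulo P: the residues of
  -- x⁰, …, x^(φ(P)-1) are φ(P) distinct units, hence all of them.
  module _ (P : ℕ) .{{_ : ℕ.NonZero P}} (P>1 : 1 < P) {x : ℤ} (o : Order P x (φ P)) where
    private
      T = φ P

      powers : List ℕ
      powers = applyUpTo (λ k → residue P (x ^ k)) T

      units : List ℕ
      units = filter (λ k → coprime? k P) (map suc (upTo P))

      unit-residue∈units : ∀ a → CoprimeTo P a → residue P a ∈ units
      unit-residue∈units a ca = ∈.∈-filter⁺ _ (in-range (residue P a) r≢0 (residue<N P a)) (λ {d} → r⊥P {d})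
        where
        r⊥P : Coprime (residue P a) P
        r⊥P = coprime-≋ {P} {+ residue P a} {a} (≋-sym (≋residue P a)) ca
        -- a residue 0 would make P a common divisor of itself and the residue
        r≢0 : residue P a ≢ 0
        r≢0 r≡0 = ℕP.<-irrefl (sym (r⊥P (subst (P ∣_) (sym r≡0) (divides 0 refl) , ∣-refl))) P>1
        in-range : ∀ r → r ≢ 0 → r < P → r ∈ map suc (upTo P)
        in-range zero r≢0 _ = ⊥-elim (r≢0 refl)
        in-range (suc r) _ r<P = ∈.∈-map⁺ suc (∈.∈-upTo⁺ (ℕP.<-trans (ℕP.n<1+n r) r<P))

      powers-unique : Unique powers
      powers-unique = AllPairs.applyUpTo⁺₁ _ T
        (λ i<j j<T rᵢ≡rⱼ → Order-distinct o i<j j<T (residue-≡⇒≋ P _ _ rᵢ≡rⱼ))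

      powers⊆units : ∀ {r} → r ∈ powers → r ∈ units
      powers⊆units r∈ = from-index (∈.∈-applyUpTo⁻ _ r∈)
        where
        from-index : ∀ {r} → ∃[ k ] (k < T × r ≡ residue P (x ^ k)) → r ∈ units
        from-index (k , _ , refl) = unit-residue∈units (x ^ k) (coprime-^ k (power≋1⇒coprime x T (positive o) (kills o)))

      |units|≤|powers| : length units ≤ length powers
      |units|≤|powers| = ℕP.≤-reflexive (sym (List.length-applyUpTo _ T))

    generates : ∀ z → CoprimeTo P z → ∃[ k ] (z ≋ x ^ k [ P ])
    generates z cz = from-index (∈.∈-applyUpTo⁻ _ (unique-⊆-≥⇒⊇ powers-unique powers⊆units |units|≤|powers| (unit-residue∈units z cz)))
      where
      from-index : ∃[ k ] (k < T × residue P z ≡ residue P (x ^ k)) → ∃[ k ] (z ≋ x ^ k [ P ])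
      from-index (k , _ , r≡) = k , residue-≡⇒≋ P z (x ^ k) r≡

module QuadraticResidues where

  open import Data.Nat as ℕ using (ℕ; zero; suc; _<_; _%_; _/_)
  import Data.Nat.Properties as ℕP
  open import Data.Nat.Divisibility using (_∣_; ∣⇒≤)
  open import Data.Nat.DivMod using (m≡m%n+[m/n]*n; m%n<n; m*n/n≡m)
  open import Data.Integer using (ℤ; +_; _*_; _^_)
  import Data.Integer.Properties as ℤP
  open import Data.List using (List; applyUpTo)
  open import Data.List.Properties using (length-applyUpTo)
  import Data.List.Relation.Unary.All.Properties as All
  import Data.List.Relation.Unary.Any.Properties as Any
  import Data.List.Relation.Unary.AllPairs.Properties as AllPairs
  open import Data.Product using (∃-syntax; _×_; _,_; proj₁)
  open import Relation.Nullary using (¬_)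
  open import Relation.Binary.PropositionalEquality using (_≡_; sym; trans; cong)
  open import Data.Integer.Tactic.RingSolver using (solve-∀)
  open import Defs
  open NatFacts using (odd⇒suc-double)
  open Congruence using (coprime-1; coprime-*; coprime-^)
  open StarCongruence

  QRTheorem : ℕ → ℕ → Set
  QRTheorem n m =
      (IsSubgroup n (QR n) × IsCyclic n (QR n) × HasOrder n (QR n) m)
    × ((b : ℤ) → QR n b → ((b ^ (suc m / 2)) ^ 2 ≡⋆ b [mod n ]) × QR n (b ^ (suc m / 2)))

  square-* : ∀ y z → y ^ 2 * z ^ 2 ≡ (y * z) ^ 2
  square-* y z = unfolded y z
    where unfolded : ∀ y z → y * (y * + 1) * (z * (z * + 1)) ≡ y * z * (y * z * + 1)
          unfolded = solve-∀

  QR-resp : ∀ {n a b} → QR n a → a ≡⋆ b [mod n ] → QR n b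
  QR-resp {n} {a} {b} (ca , y , cy , a∼y²) a≡⋆b =
    coprime-∼ (∼-sym a∼b) ca , y , cy , ∼⇒⋆ b (y ^ 2) (∼-trans (∼-sym a∼b) (⋆⇒∼ a (y ^ 2) a∼y²))
    where a∼b : a ∼ b [ n ]
          a∼b = ⋆⇒∼ a b a≡⋆b

  QR-1 : ∀ {n} → QR n (+ 1)
  QR-1 = coprime-1 , + 1 , coprime-1 , ∼⇒⋆ (+ 1) (+ 1) (∼-refl (+ 1))

  QR-* : ∀ {n a b} → QR n a → QR n b → QR n (a * b)
  QR-* {n} {a} {b} (ca , y , cy , a≡⋆y²) (cb , z , cz , b≡⋆z²) =
    coprime-* {n} {a} ca cb , y * z , coprime-* {n} {y} cy cz ,
    ∼⇒⋆ (a * b) ((y * z) ^ 2)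
      (∼-trans (∼-* (⋆⇒∼ a (y ^ 2) a≡⋆y²) (⋆⇒∼ b (z ^ 2) b≡⋆z²)) (∼-reflexive (square-* y z)))

  QR-^ : ∀ {n a} k → QR n a → QR n (a ^ k)
  QR-^ {n} zero q = QR-1 {n}
  QR-^ {n} {a} (suc k) q = QR-* {n} {a} q (QR-^ k q)

  QR-square : ∀ {n y} → CoprimeTo n y → QR n (y ^ 2)
  QR-square {n} {y} cy = coprime-^ {n} {y} 2 cy , y , cy , ∼⇒⋆ (y ^ 2) (y ^ 2) (∼-refl (y ^ 2))

  record SquareGenerator (n m : ℕ) (y : ℤ) : Set where
    field
      unit          : CoprimeTo n y
      order-divides : ∀ k → (y ^ 2) ^ k ∼ + 1 [ n ] → m ∣ k
      order-kills   : (y ^ 2) ^ m ∼ + 1 [ n ]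
      squares       : ∀ z → CoprimeTo n z → ∃[ j ] (z ^ 2 ∼ (y ^ 2) ^ j [ n ])

  module _ {n m : ℕ} (m-odd : m % 2 ≡ 1) {y : ℤ} (gen : SquareGenerator n m y) where
    open SquareGenerator gen

    private
      c : ℤ
      c = y ^ 2

      h : ℕ
      h = m / 2

      m≡1+2h : m ≡ suc (h ℕ.* 2)
      m≡1+2h = odd⇒suc-double m m-odd

      instance
        m≢0 : ℕ.NonZero m
        m≢0 rewrite m≡1+2h = _

    c-QR : QR n c
    c-QR = QR-square {n} {y} unit

    c^[j*m]∼1 : ∀ j → c ^ (j ℕ.* m) ∼ + 1 [ n ]
    c^[j*m]∼1 j = ∼-trans (∼-reflexive (trans (cong (c ^_) (ℕP.*-comm j m)) (sym (ℤP.^-*-assoc c m j))))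
                          (∼1-^ j order-kills)

    QR⇒power : ∀ b → QR n b → ∃[ j ] (b ∼ c ^ j [ n ])
    QR⇒power b (_ , z , cz , b≡⋆z²) with squares z cz
    ... | j , z²∼cʲ = j , ∼-trans (⋆⇒∼ b (z ^ 2) b≡⋆z²) z²∼cʲ

    reduce : ∀ j → c ^ j ∼ c ^ (j % m) [ n ]
    reduce j = begin
      c ^ j                                  ≡⟨ cong (c ^_) (m≡m%n+[m/n]*n j m) ⟩
      c ^ (j % m ℕ.+ j / m ℕ.* m)            ≡⟨ ℤP.^-distribˡ-+-* c (j % m) (j / m ℕ.* m) ⟩
      c ^ (j % m) * c ^ (j / m ℕ.* m)        ≈⟨ ∼-* (∼-refl (c ^ (j % m))) (c^[j*m]∼1 (j / m)) ⟩
      c ^ (j % m) * + 1                      ≡⟨ ℤP.*-identityʳ (c ^ (j % m)) ⟩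
      c ^ (j % m)                            ∎
      where open ∼-Reasoning n

    -- c^i and c^(i+d) agree only if c^d is trivial: multiply by c^(i(m-1)).
    cancel : ∀ i d → c ^ i ∼ c ^ (i ℕ.+ d) [ n ] → c ^ d ∼ + 1 [ n ]
    cancel i d e = ∼-sym (begin
      + 1                                    ≈⟨ ∼-sym (c^[j*m]∼1 i) ⟩
      c ^ (i ℕ.* m)                          ≡⟨ cong (c ^_) i*m≡t+i ⟩
      c ^ (t ℕ.+ i)                          ≡⟨ ℤP.^-distribˡ-+-* c t i ⟩
      c ^ t * c ^ i                          ≈⟨ ∼-* (∼-refl (c ^ t)) e ⟩
      c ^ t * c ^ (i ℕ.+ d)                  ≡⟨ cong (c ^ t *_) (ℤP.^-distribˡ-+-* c i d) ⟩
      c ^ t * (c ^ i * c ^ d)                ≡⟨ sym (ℤP.*-assoc (c ^ t) (c ^ i) (c ^ d)) ⟩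
      c ^ t * c ^ i * c ^ d                  ≡⟨ cong (_* c ^ d) (sym (ℤP.^-distribˡ-+-* c t i)) ⟩
      c ^ (t ℕ.+ i) * c ^ d                  ≡⟨ cong (λ k → c ^ k * c ^ d) (sym i*m≡t+i) ⟩
      c ^ (i ℕ.* m) * c ^ d                  ≈⟨ ∼-* (c^[j*m]∼1 i) (∼-refl (c ^ d)) ⟩
      + 1 * c ^ d                            ≡⟨ ℤP.*-identityˡ (c ^ d) ⟩
      c ^ d                                  ∎)
      where
      open ∼-Reasoning n
      t = i ℕ.* (h ℕ.* 2)
      i*m≡t+i : i ℕ.* m ≡ t ℕ.+ i
      i*m≡t+i = trans (cong (i ℕ.*_) m≡1+2h) (trans (ℕP.*-suc i (h ℕ.* 2)) (ℕP.+-comm i t))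

    distinct : ∀ {i j} → i < j → j < m → ¬ (c ^ i ∼ c ^ j [ n ])
    distinct {i} {j} i<j j<m e = ℕP.<⇒≱ d<m (∣⇒≤ {{ℕ.>-nonZero (ℕP.m<n⇒0<n∸m i<j)}} m∣d)
      where
      d = j ℕ.∸ i
      d<m : d < m
      d<m = ℕP.≤-<-trans (ℕP.m∸n≤m j i) j<m
      m∣d : m ∣ d
      m∣d = order-divides d (cancel i d (∼-trans e (∼-reflexive (cong (c ^_) (sym (ℕP.m+[n∸m]≡n (ℕP.<⇒≤ i<j)))))))

    powers : List ℤ
    powers = applyUpTo (c ^_) m

    subgroup : IsSubgroup n (QR n)
    subgroup = (λ _ → proj₁) , (λ a b → QR-resp {n} {a} {b}) , QR-1 {n} , (λ a b → QR-* {n} {a} {b}) , inverse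
      where
      -- the inverse of b ∼ cʲ is c^(j(m-1))
      inverse : ∀ b → QR n b → ∃[ b⁻¹ ] (QR n b⁻¹ × b * b⁻¹ ≡⋆ + 1 [mod n ])
      inverse b q with QR⇒power b q
      ... | j , b∼cʲ = c ^ (j ℕ.* (h ℕ.* 2)) , QR-^ {n} {c} (j ℕ.* (h ℕ.* 2)) c-QR , ∼⇒⋆ _ _ (begin
        b * c ^ (j ℕ.* (h ℕ.* 2))              ≈⟨ ∼-* b∼cʲ (∼-refl _) ⟩
        c ^ j * c ^ (j ℕ.* (h ℕ.* 2))          ≡⟨ sym (ℤP.^-distribˡ-+-* c j _) ⟩
        c ^ (j ℕ.+ j ℕ.* (h ℕ.* 2))            ≡⟨ cong (c ^_) (trans (sym (ℕP.*-suc j _)) (cong (j ℕ.*_) (sym m≡1+2h))) ⟩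
        c ^ (j ℕ.* m)                          ≈⟨ c^[j*m]∼1 j ⟩
        + 1                                    ∎)
        where open ∼-Reasoning n

    cyclic : IsCyclic n (QR n)
    cyclic = c , c-QR , λ b q → let (j , b∼cʲ) = QR⇒power b q in j , ∼⇒⋆ b (c ^ j) b∼cʲ

    order : HasOrder n (QR n) m
    order = powers
          , All.applyUpTo⁺₂ (c ^_) m (λ k → QR-^ {n} {c} k c-QR)
          , AllPairs.applyUpTo⁺₁ (c ^_) m (λ i<j j<m e → distinct i<j j<m (⋆⇒∼ _ _ e))
          , cover
          , length-applyUpTo (c ^_) m
      where
      cover : ∀ b → QR n b → _
      cover b q with QR⇒power b q
      ... | j , b∼cʲ = Any.applyUpTo⁺ (c ^_) (∼⇒⋆ b _ (∼-trans b∼cʲ (reduce j))) (m%n<n j m)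

    -- Every quadratic residue b satisfies bᵐ ∼ 1, so b^((m+1)/2) is a square root of b.
    QR^m∼1 : ∀ b → QR n b → b ^ m ∼ + 1 [ n ]
    QR^m∼1 b q with QR⇒power b q
    ... | j , b∼cʲ = ∼-trans (∼-^ m b∼cʲ)
        (∼-trans (∼-reflexive (ℤP.^-*-assoc c j m)) (c^[j*m]∼1 j))

    [m+1]/2*2≡m+1 : suc m / 2 ℕ.* 2 ≡ suc m
    [m+1]/2*2≡m+1 = trans (cong (λ k → suc k / 2 ℕ.* 2) m≡1+2h)
                      (trans (cong (ℕ._* 2) (m*n/n≡m (suc h) 2)) (cong suc (sym m≡1+2h)))

    square-root : ∀ b → QR n b → ((b ^ (suc m / 2)) ^ 2 ≡⋆ b [mod n ]) × QR n (b ^ (suc m / 2))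
    square-root b q = ∼⇒⋆ _ b (begin
      (b ^ (suc m / 2)) ^ 2                  ≡⟨ trans (ℤP.^-*-assoc b (suc m / 2) 2) (cong (b ^_) [m+1]/2*2≡m+1) ⟩
      b * b ^ m                              ≈⟨ ∼-* (∼-refl b) (QR^m∼1 b q) ⟩
      b * + 1                                ≡⟨ ℤP.*-identityʳ b ⟩
      b                                      ∎) , QR-^ {n} {b} (suc m / 2) q
      where open ∼-Reasoning n

    qr-theorem : QRTheorem n m
    qr-theorem = (subgroup , cyclic , order) , square-root

module TwoCases where

  open import Data.Nat as ℕ using (ℕ; suc; _≤_; _<_; _%_)
  import Data.Nat.Properties as ℕP
  open import Data.Nat.Divisibility as ℕ∣ using (_∣_; divides)
  open import Data.Nat.Coprimality using (Coprime)
  import Data.Nat.Coprimality as Coprimality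
  open import Data.Nat.GCD using (gcd; gcd[m,n]∣m; gcd[m,n]∣n; gcd-greatest)
  open import Data.Nat.Primality using (Prime; prime⇒nonZero; prime[2])
  import Data.Nat.Tactic.RingSolver as ℕSolver
  open import Data.Integer using (ℤ; +_; _+_; _*_; _-_; -_; _^_)
  import Data.Integer.Properties as ℤP
  import Data.Integer.Divisibility.Signed as ℤ∣
  open import Data.Integer.Tactic.RingSolver using (solve-∀)
  open import Data.Product using (∃-syntax; _×_; _,_; proj₁; proj₂)
  open import Data.Sum using (_⊎_; inj₁; inj₂)
  open import Relation.Nullary using (¬_; yes; no)
  open import Relation.Binary.PropositionalEquality using (_≡_; _≢_; refl; sym; trans; cong; cong₂; subst)
  open import Defs using (φ; CoprimeTo)
  open NatFacts
  open IntegerDivisibility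
  open Congruence
  open StarCongruence
  open Orders
  open Totient using (φ-prime-power; φ-two-prime-powers)
  open LiftingToPrimePowers using (good-root; order-lift)
  open Generators using (generates)
  open QuadraticResidues using (QRTheorem; SquareGenerator; qr-theorem)

  -- Modulo a power of an odd prime, the only square roots of 1 are ±1: p cannot
  -- divide both factors of x² - 1 = (x - 1)(x + 1), since it would divide 2.
  square-root-of-unity : ∀ {p} k → Prime p → p ≢ 2 → ∀ x → x * x ≋ + 1 [ p ℕ.^ k ] → x ≋ + 1 [ p ℕ.^ k ] ⊎ x ≋ - + 1 [ p ℕ.^ k ]
  square-root-of-unity {p} k pp p≢2 x x²≋1 with p ∣ℤ? (x - + 1)
  ... | no p∤x-1 = inj₂ (mk≋ (subst (_ ∣ℤ_) (x+1≡x--1 x) (prime-power-cancel k pp (x - + 1) (x + + 1) pᵏ∣[x-1][x+1] p∤x-1)))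
    where
    pᵏ∣[x-1][x+1] : + (p ℕ.^ k) ∣ℤ (x - + 1) * (x + + 1)
    pᵏ∣[x-1][x+1] = subst (_ ∣ℤ_) (difference-of-squares x) (N∣a-b x²≋1)
      where difference-of-squares : ∀ x → x * x - + 1 ≡ (x - + 1) * (x + + 1)
            difference-of-squares = solve-∀
    x+1≡x--1 : ∀ x → x + + 1 ≡ x - - + 1
    x+1≡x--1 = solve-∀
  ... | yes p∣x-1 = inj₁ (mk≋ (prime-power-cancel k pp (x + + 1) (x - + 1) pᵏ∣[x+1][x-1] p∤x+1))
    where
    pᵏ∣[x+1][x-1] : + (p ℕ.^ k) ∣ℤ (x + + 1) * (x - + 1)
    pᵏ∣[x+1][x-1] = subst (_ ∣ℤ_) (difference-of-squares x) (N∣a-b x²≋1)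
      where difference-of-squares : ∀ x → x * x - + 1 ≡ (x + + 1) * (x - + 1)
            difference-of-squares = solve-∀
    p∤x+1 : ¬ (+ p ∣ℤ x + + 1)
    p∤x+1 p∣x+1 = p≢2 (prime∣2⇒≡2 pp (∣ℤ⇒∣ (+ 2) (subst (_ ∣ℤ_) (difference x) (ℤ∣.∣m∣n⇒∣m-n p∣x+1 p∣x-1))))
      where difference : ∀ x → (x + + 1) - (x - + 1) ≡ + 2
            difference = solve-∀

  record PrimitiveRoot (P : ℕ) (h : ℤ) : Set where
    field
      order-φ : Order P h (φ P)
      covers  : ∀ z → CoprimeTo P z → ∃[ k ] (z ≋ h ^ k [ P ])

  primitive-root-odd-prime-power : ∀ {p} → Prime p → p ≢ 2 → ∀ α → ∃[ h ] PrimitiveRoot (p ℕ.^ suc α) h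
  primitive-root-odd-prime-power {p} pp p≢2 α with good-root p pp p≢2
  ... | h , oh , exact = h , record { order-φ = hᵒ ; covers = generates P P>1 hᵒ }
    where
    P = p ℕ.^ suc α
    instance
      p≢0 = prime⇒nonZero pp
      P≢0 : ℕ.NonZero P
      P≢0 = ℕ.>-nonZero (ℕP.m^n>0 p (suc α))
    P>1 : 1 < P
    P>1 = ℕP.<-≤-trans (prime>1 pp) (ℕP.m≤m*n p (p ℕ.^ α) {{ℕ.>-nonZero (ℕP.m^n>0 p α)}})
    hᵒ : Order P h (φ P)
    hᵒ = subst (Order P h) (sym (φ-prime-power pp α)) (order-lift p pp p≢2 oh exact α)

  square-^ : ∀ y k → (y ^ k) ^ 2 ≡ (y ^ 2) ^ k
  square-^ y k = trans (ℤP.^-*-assoc y k 2) (trans (cong (y ^_) (ℕP.*-comm k 2)) (sym (ℤP.^-*-assoc y 2 k)))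

  square-^-twice : ∀ y k → (y ^ 2) ^ k * (y ^ 2) ^ k ≡ y ^ (4 ℕ.* k)
  square-^-twice y k = trans (sym (ℤP.^-distribˡ-+-* (y ^ 2) k k)) (trans (ℤP.^-*-assoc y 2 (k ℕ.+ k)) (cong (y ^_) (double k)))
    where double : ∀ k → 2 ℕ.* (k ℕ.+ k) ≡ 4 ℕ.* k
          double = ℕSolver.solve-∀

  ∼1⇒fourth-power≋1 : ∀ {N} y k → (y ^ 2) ^ k ∼ + 1 [ N ] → y ^ (4 ℕ.* k) ≋ + 1 [ N ]
  ∼1⇒fourth-power≋1 y k e = ≋-trans (≋-reflexive (sym (square-^-twice y k))) (∼1⇒square≋1 e)

  -- Case n = p^k: the square of a primitive root h generates the squares, and since
  -- φ(n) = 4m and h^(2m) is a square root of 1, i.e. ±1, it has order m in G⋆ₙ.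
  prime-power-generator : ∀ {p} k → Prime p → p ≢ 2 → ∀ {h m} → PrimitiveRoot (p ℕ.^ k) h →
                          φ (p ℕ.^ k) ≡ 4 ℕ.* m → SquareGenerator (p ℕ.^ k) m h
  prime-power-generator {p} k pp p≢2 {h} {m} root φ≡4m = record
    { unit          = power≋1⇒coprime h (φ P) (positive hᵒ) (kills hᵒ)
    ; order-divides = λ j e → ℕ∣.*-cancelˡ-∣ 4 (subst (_∣ 4 ℕ.* j) φ≡4m (minimal hᵒ (4 ℕ.* j) (∼1⇒fourth-power≋1 h j e)))
    ; order-kills   = mk∼ (square-root-of-unity k pp p≢2 ((h ^ 2) ^ m) h^[4m]≋1)
    ; squares       = λ z cz → let (j , z≋hʲ) = covers z cz in
                        j , ≋⇒∼ (≋-trans (≋-^ 2 z≋hʲ) (≋-reflexive (square-^ h j)))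
    }
    where
    P = p ℕ.^ k
    open PrimitiveRoot root renaming (order-φ to hᵒ)
    h^[4m]≋1 : (h ^ 2) ^ m * (h ^ 2) ^ m ≋ + 1 [ P ]
    h^[4m]≋1 = ≋-trans (≋-reflexive (square-^-twice h m)) (subst (λ t → h ^ t ≋ + 1 [ P ]) φ≡4m (kills hᵒ))

  -- Case n = P·Q with P, Q coprime, primitive roots h_P, h_Q of orders 2a, 2b, and
  -- a, b odd and coprime: the element Y ≡ h_P (mod P), Y ≡ h_Q (mod Q) works, with
  -- m = ab.  Everything is checked modulo P and modulo Q separately.
  module _ {P Q : ℕ} (P⊥Q : Coprime P Q) {hP hQ : ℤ} (rootP : PrimitiveRoot P hP) (rootQ : PrimitiveRoot Q hQ)
           {a b : ℕ} (φP≡ : φ P ≡ a ℕ.* 2) (φQ≡ : φ Q ≡ b ℕ.* 2)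
           (a⊥b : Coprime a b) (a⊥2 : Coprime a 2) (b⊥2 : Coprime b 2) where
    private
      module RP = PrimitiveRoot rootP
      module RQ = PrimitiveRoot rootQ

      Y : ℤ
      Y = proj₁ (crt P⊥Q hP hQ)
      Y≋hP : Y ≋ hP [ P ]
      Y≋hP = proj₁ (proj₂ (crt P⊥Q hP hQ))
      Y≋hQ : Y ≋ hQ [ Q ]
      Y≋hQ = proj₂ (proj₂ (crt P⊥Q hP hQ))

      hPᵒ : Order P hP (a ℕ.* 2)
      hPᵒ = subst (Order P hP) φP≡ RP.order-φ
      hQᵒ : Order Q hQ (b ℕ.* 2)
      hQᵒ = subst (Order Q hQ) φQ≡ RQ.order-φ

      odd-half-∣ : ∀ {N x A} k → Order N x (A ℕ.* 2) → Coprime A 2 → x ^ (4 ℕ.* k) ≋ + 1 [ N ] → A ∣ k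
      odd-half-∣ {A = A} k o A⊥2 e = Coprimality.coprime-divisor A⊥2
        (ℕ∣.*-cancelʳ-∣ 2 (subst (A ℕ.* 2 ∣_) (four k) (minimal o (4 ℕ.* k) e)))
        where four : ∀ k → 4 ℕ.* k ≡ 2 ℕ.* k ℕ.* 2
              four = ℕSolver.solve-∀

      kills-ab : ∀ {M h A} B → Y ≋ h [ M ] → Order M h (A ℕ.* 2) → (Y ^ 2) ^ (A ℕ.* B) ≋ + 1 [ M ]
      kills-ab {M} {h} {A} B Y≋h o = ≋-trans (≋-reflexive (trans (ℤP.^-*-assoc Y 2 (A ℕ.* B)) (cong (Y ^_) (shuffle A B))))
                                       (≋-trans (≋-^ (A ℕ.* 2 ℕ.* B) Y≋h) (power≋1-* (A ℕ.* 2) (kills o) B))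
        where shuffle : ∀ A B → 2 ℕ.* (A ℕ.* B) ≡ A ℕ.* 2 ℕ.* B
              shuffle = ℕSolver.solve-∀

      match : ∀ {M h A z k j} → Y ≋ h [ M ] → Order M h (A ℕ.* 2) → z ≋ h ^ k [ M ] → + j ≋ + k [ A ] →
              z ^ 2 ≋ (Y ^ 2) ^ j [ M ]
      match {M} {h} {A} {z} {k} {j} Y≋h o z≋hᵏ j≋k = begin
        z ^ 2           ≈⟨ ≋-^ 2 z≋hᵏ ⟩
        (h ^ k) ^ 2     ≡⟨ square-^ h k ⟩
        (h ^ 2) ^ k     ≈⟨ power-≋-exponent h²ᴬ≋1 (≋-sym j≋k) ⟩
        (h ^ 2) ^ j     ≈⟨ ≋-^ j (≋-^ 2 (≋-sym Y≋h)) ⟩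
        (Y ^ 2) ^ j     ∎
        where
        open ≋-Reasoning M
        h²ᴬ≋1 : (h ^ 2) ^ A ≋ + 1 [ M ]
        h²ᴬ≋1 = ≋-trans (≋-reflexive (trans (ℤP.^-*-assoc h 2 A) (cong (h ^_) (ℕP.*-comm 2 A)))) (kills o)

      instance
        ab≢0 : ℕ.NonZero (a ℕ.* b)
        ab≢0 = ℕ.>-nonZero (ℕP.*-mono-≤ (proj₁ (factors-pos a 2 (positive hPᵒ))) (proj₁ (factors-pos b 2 (positive hQᵒ))))

    two-prime-generator : ∃[ Y ] SquareGenerator (P ℕ.* Q) (a ℕ.* b) Y
    two-prime-generator = Y , record
      { unit          = coprime-join Y (coprime-≋ Y≋hP (power≋1⇒coprime hP _ (positive hPᵒ) (kills hPᵒ)))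
                                       (coprime-≋ Y≋hQ (power≋1⇒coprime hQ _ (positive hQᵒ) (kills hQᵒ)))
      ; order-divides = λ k e → let Y⁴ᵏ≋1 = ∼1⇒fourth-power≋1 Y k e in
          coprime-∣-* a⊥b (odd-half-∣ k hPᵒ a⊥2 (≋-trans (≋-^ (4 ℕ.* k) (≋-sym Y≋hP)) (≋-weaken (ℕ∣.m∣m*n Q) Y⁴ᵏ≋1)))
                          (odd-half-∣ k hQᵒ b⊥2 (≋-trans (≋-^ (4 ℕ.* k) (≋-sym Y≋hQ)) (≋-weaken (ℕ∣.n∣m*n P) Y⁴ᵏ≋1)))
      ; order-kills   = ≋⇒∼ (≋-join P⊥Q (kills-ab {A = a} b Y≋hP hPᵒ)
                                          (subst (λ e → (Y ^ 2) ^ e ≋ + 1 [ Q ]) (ℕP.*-comm b a) (kills-ab {A = b} a Y≋hQ hQᵒ)))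
      ; squares       = squares
      }
      where
      squares : ∀ z → CoprimeTo (P ℕ.* Q) z → ∃[ j ] (z ^ 2 ∼ (Y ^ 2) ^ j [ P ℕ.* Q ])
      squares z cz = from-logs (RP.covers z (proj₁ (coprime-split {P} {Q} z cz)))
                               (RQ.covers z (proj₂ (coprime-split {P} {Q} z cz)))
        where
        from-logs : ∃[ k ] (z ≋ hP ^ k [ P ]) → ∃[ l ] (z ≋ hQ ^ l [ Q ]) → ∃[ j ] (z ^ 2 ∼ (Y ^ 2) ^ j [ P ℕ.* Q ])
        from-logs (k , z≋hPᵏ) (l , z≋hQˡ) = j , ≋⇒∼ (≋-join P⊥Q (match Y≋hP hPᵒ z≋hPᵏ j≋k) (match Y≋hQ hQᵒ z≋hQˡ j≋l))
          where
          -- choose j ≡ k (mod a) and j ≡ l (mod b), as a residue modulo ab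
          w : ∃[ w ] (w ≋ + k [ a ] × w ≋ + l [ b ])
          w = crt a⊥b (+ k) (+ l)
          j : ℕ
          j = residue (a ℕ.* b) (proj₁ w)
          j≋w : + j ≋ proj₁ w [ a ℕ.* b ]
          j≋w = ≋-sym (≋residue (a ℕ.* b) (proj₁ w))
          j≋k : + j ≋ + k [ a ]
          j≋k = ≋-trans (≋-weaken (ℕ∣.m∣m*n b) j≋w) (proj₁ (proj₂ w))
          j≋l : + j ≋ + l [ b ]
          j≋l = ≋-trans (≋-weaken (ℕ∣.n∣m*n a) j≋w) (proj₂ (proj₂ w))

  gcd≡2-split : ∀ A B → gcd A B ≡ 2 → ∃[ a ] ∃[ b ] (A ≡ a ℕ.* 2 × B ≡ b ℕ.* 2 × Coprime a b)
  gcd≡2-split A B g≡2 with subst (_∣ A) g≡2 (gcd[m,n]∣m A B) | subst (_∣ B) g≡2 (gcd[m,n]∣n A B)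
  ... | divides a A≡ | divides b B≡ = a , b , A≡ , B≡ , a⊥b
    where
    a⊥b : Coprime a b
    a⊥b {d} (d∣a , d∣b) = ℕ∣.∣1⇒≡1 (ℕ∣.*-cancelʳ-∣ 2 (subst (d ℕ.* 2 ∣_) g≡2
      (gcd-greatest (subst (d ℕ.* 2 ∣_) (sym A≡) (ℕ∣.*-monoˡ-∣ 2 d∣a)) (subst (d ℕ.* 2 ∣_) (sym B≡) (ℕ∣.*-monoˡ-∣ 2 d∣b)))))

  odd⇒coprime-2 : ∀ {m} → m % 2 ≡ 1 → Coprime m 2
  odd⇒coprime-2 {m} m-odd = Coprimality.sym (prime-coprime prime[2] 2∤m)
    where 2∤m : ¬ (2 ∣ m)
          2∤m 2∣m with trans (sym (ℕ∣.n∣m⇒m%n≡0 m 2 2∣m)) m-odd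
          ... | ()

  prime-power-case : ∀ {p} α m → Prime p → p ≢ 2 → 1 ≤ α → φ (p ℕ.^ α) ≡ 4 ℕ.* m → m % 2 ≡ 1 → QRTheorem (p ℕ.^ α) m
  prime-power-case {p} (suc α) m pp p≢2 _ φ≡4m m-odd =
    qr-theorem m-odd (prime-power-generator (suc α) pp p≢2 (proj₂ (primitive-root-odd-prime-power pp p≢2 α)) φ≡4m)

  two-prime-power-case : ∀ {p q} α β m → Prime p → Prime q → p ≢ 2 → q ≢ 2 → p ≢ q → 1 ≤ α → 1 ≤ β →
    gcd (φ (p ℕ.^ α)) (φ (q ℕ.^ β)) ≡ 2 → φ (p ℕ.^ α ℕ.* q ℕ.^ β) ≡ 4 ℕ.* m → m % 2 ≡ 1 →
    QRTheorem (p ℕ.^ α ℕ.* q ℕ.^ β) m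
  two-prime-power-case {p} {q} (suc α) (suc β) m pp pq p≢2 q≢2 p≢q _ _ g≡2 φ≡4m m-odd
    with gcd≡2-split (φ (p ℕ.^ suc α)) (φ (q ℕ.^ suc β)) g≡2
  ... | a , b , φP≡ , φQ≡ , a⊥b =
    let (Y , generator) = two-prime-generator P⊥Q (proj₂ (primitive-root-odd-prime-power pp p≢2 α))
                            (proj₂ (primitive-root-odd-prime-power pq q≢2 β)) φP≡ φQ≡ a⊥b a⊥2 b⊥2
    in qr-theorem m-odd (subst (λ k → SquareGenerator N k Y) (sym m≡ab) generator)
    where
    P = p ℕ.^ suc α
    Q = q ℕ.^ suc β
    N = P ℕ.* Q
    P⊥Q : Coprime P Q
    P⊥Q = coprime-^ˡ (suc α) (Coprimality.sym (coprime-^ˡ (suc β) (Coprimality.sym (distinct-primes-coprime pp pq p≢q))))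
    -- 4m = φ(P)φ(Q) = 4ab
    m≡ab : m ≡ a ℕ.* b
    m≡ab = ℕP.*-cancelˡ-≡ m (a ℕ.* b) 4 (trans (sym φ≡4m) (trans (φ-two-prime-powers pp pq p≢q α β)
             (trans (cong₂ ℕ._*_ φP≡ φQ≡) (regroup a b))))
      where regroup : ∀ a b → a ℕ.* 2 ℕ.* (b ℕ.* 2) ≡ 4 ℕ.* (a ℕ.* b)
            regroup = ℕSolver.solve-∀
    -- a and b divide the odd number m, so they are odd
    m⊥2 : Coprime m 2
    m⊥2 = odd⇒coprime-2 m-odd
    a⊥2 : Coprime a 2
    a⊥2 (d∣a , d∣2) = m⊥2 (ℕ∣.∣-trans d∣a (subst (a ∣_) (sym m≡ab) (ℕ∣.m∣m*n b)) , d∣2)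
    b⊥2 : Coprime b 2
    b⊥2 (d∣b , d∣2) = m⊥2 (ℕ∣.∣-trans d∣b (subst (b ∣_) (sym m≡ab) (ℕ∣.n∣m*n a)) , d∣2)

open import Data.Nat using (ℕ; suc; _*_; _%_; _/_)
open import Data.Integer using (ℤ; _^_)
open import Data.Product using (_×_; _,_)
open import Data.Sum using (inj₁; inj₂)
open import Relation.Binary.PropositionalEquality using (_≡_; refl)
open import Defs
open TwoCases using (prime-power-case; two-prime-power-case)

mainTheorem6 : (n : ℕ) → ShapeN n → (m : ℕ) → φ n ≡ 4 * m → m % 2 ≡ 1 →
    (IsSubgroup n (QR n) × IsCyclic n (QR n) × HasOrder n (QR n) m)
    × ((b : ℤ) → QR n b →
        ((b ^ (suc m / 2)) ^ 2 ≡⋆ b [mod n ]) × QR n (b ^ (suc m / 2)))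
mainTheorem6 n (inj₁ (p , α , pp , p≢2 , α≥1 , refl)) m =
  prime-power-case α m pp p≢2 α≥1
mainTheorem6 n (inj₂ (p , q , α , β , pp , pq , p≢2 , q≢2 , p≢q , α≥1 , β≥1 , gcd≡2 , refl)) m =
  two-prime-power-case α β m pp pq p≢2 q≢2 p≢q α≥1 β≥1 gcd≡2
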